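{- Let $B=\{(a,b):a,b\in\{1,2,3\}\}$. For each of the following sets $T$, with $R=B\cup T$, we have $(123,R)\sim_d(132,R)$: (1) $T=\{(0,0)\}$; (2) $T=\{(0,1),(1,0)\}$; (3) $T=\{(0,0),(0,1),(1,0)\}$; (4) $T=\{(0,2),(2,0)\}$; (5) $T=\{(0,0),(0,2),(2,0)\}$; (6) $T=\{(0,1),(0,2),(1,0),(2,0)\}$; (7) $T=\{(0,0),(0,1),(0,2),(1,0),(2,0)\}$.
   Context: $S_n$ denotes the set of permutations of $[n]=\{1,\dots,n\}$, written $\pi=\pi_1\cdots\pi_n$. A mesh pattern of length $k$ is a pair $(\tau,R)$ with $\tau\in S_k$ and $R\subseteq\{0,1,\dots,k\}^2$ (the shaded boxes; box $(a,b)$ is the unit square $[a,a+1]\times[b,b+1]$ in the diagram of $\tau$). An occurrence of $(\tau,R)$ in $\pi\in S_n$ is a choice of indices $i_1<\dots<i_k$ such that $\pi_{i_1}\cdots\pi_{i_k}$ is order-isomorphic to $\tau$ and, with $i_0=0$, $i_{k+1}=n+1$, $v_1<\dots<v_k$ the values $\pi_{i_1},\dots,\pi_{i_k}$ sorted increasingly, $v_0=0$, $v_{k+1}=n+1$, for every $(a,b)\in R$ there is no index $m$ with $i_a<m<i_{a+1}$ and $v_b<\pi_m<v_{b+1}$. Mesh patterns $p,q$ are equidistributed, $p\sim_d q$, if for all $n,\ell\ge0$ the number of $\pi\in S_n$ with exactly $\ell$ occurrences of $p$ equals the number with exactly $\ell$ occurrences of $q$. -}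

module Defs where

open import Data.Nat using (ℕ; zero; suc; _+_; _<ᵇ_; _≡ᵇ_)
open import Data.Bool using (Bool; true; false; _∧_; _∨_; not; if_then_else_)
open import Data.List using (List; []; _∷_; _++_; map; length; filter; concatMap; upTo; applyUpTo)
open import Data.Bool.ListAction using (any; all)
open import Data.Product using (_×_; _,_)
open import Relation.Binary.PropositionalEquality using (_≡_)

-- ℕ-lists, 1-based lookup with default 0
at : List ℕ → ℕ → ℕ
at []       _             = 0
at (x ∷ xs) zero          = x
at (x ∷ xs) (suc zero)    = x
at (x ∷ xs) (suc (suc i)) = at xs (suc i)

at₀ : List ℕ → ℕ → ℕ
at₀ []       _       = 0
at₀ (x ∷ xs) zero    = x
at₀ (x ∷ xs) (suc i) = at₀ xs i

range1 : ℕ → List ℕ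
range1 n = applyUpTo suc n

insert : ℕ → List ℕ → List ℕ
insert x []       = x ∷ []
insert x (y ∷ ys) = if x <ᵇ y then x ∷ y ∷ ys else y ∷ insert x ys

sort : List ℕ → List ℕ
sort []       = []
sort (x ∷ xs) = insert x (sort xs)

memb : ℕ → List ℕ → Bool
memb x xs = any (λ y → x ≡ᵇ y) xs

distinct : List ℕ → Bool
distinct []       = true
distinct (x ∷ xs) = not (memb x xs) ∧ distinct xs

words : ℕ → ℕ → List (List ℕ)
words n zero    = [] ∷ []
words n (suc k) = concatMap (λ x → map (x ∷_) (words n k)) (range1 n)

-- S_n: permutations of [n] as one-line words π₁⋯πₙ
perms : ℕ → List (List ℕ)
perms n = filter (λ w → distinct w ≟B true) (words n n)
  where
  open import Data.Bool using () renaming (_≟_ to _≟B_)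

-- strictly increasing lists of length k from [lo..lo+len-1]: index tuples i₁<⋯<i_k
choose : ℕ → ℕ → ℕ → List (List ℕ)
choose lo len       zero    = [] ∷ []
choose lo zero      (suc k) = []
choose lo (suc len) (suc k) = map (lo ∷_) (choose (suc lo) len k) ++ choose (suc lo) len (suc k)

-- mesh pattern (τ , R): τ as a one-line word over [k], R the shaded boxes
record Mesh : Set where
  constructor mesh
  field
    τ : List ℕ
    R : List (ℕ × ℕ)
open Mesh public

-- is the index tuple `is` (increasing, 1-based) an occurrence of p in π ∈ S_n?
isOcc : Mesh → List ℕ → List ℕ → Bool
isOcc (mesh τ R) π is =
  orderIso ∧ all boxEmpty R
  where
  n = length π
  k = length τ
  vals = map (at π) is
  ks = upTo k
  orderIso = all (λ a → all (λ b → (at₀ vals a <ᵇ at₀ vals b) ≡ᵇB (at₀ τ a <ᵇ at₀ τ b)) ks) ks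
    where
    _≡ᵇB_ : Bool → Bool → Bool
    true  ≡ᵇB y = y
    false ≡ᵇB y = not y
  -- positions i₀=0, i₁..i_k, i_{k+1}=n+1 ; values v₀=0, sorted values, v_{k+1}=n+1
  pos = 0 ∷ is ++ (suc n ∷ [])
  vs  = 0 ∷ sort vals ++ (suc n ∷ [])
  boxEmpty : ℕ × ℕ → Bool
  boxEmpty (a , b) =
    not (any (λ m → (at₀ pos a <ᵇ m) ∧ (m <ᵇ at₀ pos (suc a))
                  ∧ (at₀ vs b <ᵇ at π m) ∧ (at π m <ᵇ at₀ vs (suc b)))
             (range1 n))

occ : Mesh → List ℕ → ℕ
occ p π = length (filter (λ is → isOcc p π is ≟B true) (choose 1 (length π) (length (τ p))))
  where
  open import Data.Bool using () renaming (_≟_ to _≟B_)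

countPerms : Mesh → ℕ → ℕ → ℕ
countPerms p n ℓ = length (filter (λ π → occ p π ≟ ℓ) (perms n))
  where
  open import Data.Nat using (_≟_)

_∼d_ : Mesh → Mesh → Set
p ∼d q = ∀ n ℓ → countPerms p n ℓ ≡ countPerms q n ℓ

B : List (ℕ × ℕ)
B = concatMap (λ a → map (a ,_) (1 ∷ 2 ∷ 3 ∷ [])) (1 ∷ 2 ∷ 3 ∷ [])

Ts : List (List (ℕ × ℕ))
Ts = ((0 , 0) ∷ [])
   ∷ ((0 , 1) ∷ (1 , 0) ∷ [])
   ∷ ((0 , 0) ∷ (0 , 1) ∷ (1 , 0) ∷ [])
   ∷ ((0 , 2) ∷ (2 , 0) ∷ [])
   ∷ ((0 , 0) ∷ (0 , 2) ∷ (2 , 0) ∷ [])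
   ∷ ((0 , 1) ∷ (0 , 2) ∷ (1 , 0) ∷ (2 , 0) ∷ [])
   ∷ ((0 , 0) ∷ (0 , 1) ∷ (0 , 2) ∷ (1 , 0) ∷ (2 , 0) ∷ [])
   ∷ []

p123 p132 : List ℕ
p123 = 1 ∷ 2 ∷ 3 ∷ []
p132 = 1 ∷ 3 ∷ 2 ∷ []

_ : occ (mesh p123 []) (1 ∷ 2 ∷ 3 ∷ 4 ∷ []) ≡ 4
_ = Relation.Binary.PropositionalEquality.refl
_ : length (perms 4) ≡ 24
_ = Relation.Binary.PropositionalEquality.refl
_ : occ (mesh p123 ((0 , 0) ∷ [])) (2 ∷ 3 ∷ 1 ∷ 4 ∷ []) ≡ 1
_ = Relation.Binary.PropositionalEquality.refl
_ : occ (mesh p123 ((0 , 0) ∷ [])) (1 ∷ 2 ∷ 3 ∷ 4 ∷ []) ≡ 3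
_ = Relation.Binary.PropositionalEquality.refl
_ : occ (mesh p132 ((3 , 3) ∷ [])) (1 ∷ 4 ∷ 3 ∷ 2 ∷ []) ≡ 3
_ = Relation.Binary.PropositionalEquality.refl
_ : occ (mesh p132 ((2 , 0) ∷ [])) (2 ∷ 4 ∷ 1 ∷ 3 ∷ []) ≡ 0
_ = Relation.Binary.PropositionalEquality.refl
_ : occ (mesh p132 ((1 , 1) ∷ [])) (1 ∷ 4 ∷ 3 ∷ []) ≡ 1
_ = Relation.Binary.PropositionalEquality.refl

{-# OPTIONS --safe #-}
-- Shading B says that the only points to the right of and above the first point x of an
-- occurrence are its two other points j < k, so each x is the first point of at most one
-- occurrence of 123 or 132, and the pattern is decided by the order of the values at j and k.
-- Swapping those two values turns the one pattern into the other; when T consists of boxes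
-- among (0,0), (0,1), (0,2), (1,0), (2,0), the swap creates or destroys no occurrence with a
-- different middle point (it can only move their last point between the two swapped
-- positions).  Swapping in turn for every middle point a = 1, …, n therefore exchanges the
-- two patterns at every first point, and undoing the swaps in reverse order inverts it, so
-- this map is an injection of S_n into itself carrying occurrences of one pattern to the other.
module Submission where

open import Defs
open import Data.Bool using (Bool; true; false; _∧_; _∨_; not; if_then_else_) renaming (T to True)
open import Data.Bool using () renaming (_≟_ to _≟ᵇ_)
open import Data.Bool.ListAction using (any; all)
open import Data.Bool.Properties using (T-≡; T-∨; ⇔→≡; not-involutive)
open import Data.Empty using (⊥-elim)
open import Data.List using (List; []; _∷_; _++_; map; length; filter; concatMap; applyUpTo; findᵇ)
open import Data.List.Properties using (length-++; length-map; length-applyUpTo; filter-++; filter-none)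
open import Data.List.Membership.Propositional using (_∈_; _∉_; find; lose)
open import Data.List.Membership.Propositional.Properties
  using (∈-applyUpTo⁺; ∈-applyUpTo⁻; ∈-map⁺; ∈-map⁻; ∈-++⁺ˡ; ∈-++⁺ʳ; ∈-++⁻; ∈-∃++; ∈-filter⁺; ∈-filter⁻)
open import Data.List.Relation.Unary.All using (All; []; _∷_)
import Data.List.Relation.Unary.All as All
open import Data.List.Relation.Unary.All.Properties using (all⁺; all⁻; ++⁺; ++⁻)
open import Data.List.Relation.Unary.Any using (here; there)
import Data.List.Relation.Unary.Any as Any
open import Data.List.Relation.Unary.Any.Properties using (any⁺; any⁻; concatMap⁺; concatMap⁻)
open import Data.List.Relation.Unary.Unique.Propositional using (Unique; []; _∷_)
import Data.List.Relation.Unary.Unique.Propositional.Properties as Unique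
open import Data.Maybe using (Maybe; just; nothing; maybe′)
open import Data.Nat
open import Data.Nat.Properties
open import Data.Product using (_×_; _,_; proj₁; proj₂; ∃; ∃-syntax; ∄-syntax)
open import Data.Sum using (_⊎_; inj₁; inj₂)
open import Data.Unit using (tt)
open import Function using (_∘_; _⇔_; mk⇔; Equivalence)
open import Function.Properties.Equivalence using () renaming (refl to ⇔-refl; sym to ⇔-sym; trans to ⇔-trans)
open import Relation.Binary.Definitions using (tri<; tri≈; tri>)
open import Relation.Binary.PropositionalEquality
open import Relation.Nullary using (¬_; yes; no; contradiction)

True-∧⁻ : ∀ x {y} → True (x ∧ y) → True x × True y
True-∧⁻ true t = tt , t

True-∧⁺ : ∀ {x y} → True x → True y → True (x ∧ y)
True-∧⁺ {true} _ t = t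

True-not⁺ : ∀ {x} → ¬ True x → True (not x)
True-not⁺ {false} _ = tt
True-not⁺ {true} ¬t = ¬t tt

True-not⁻ : ∀ {x} → True (not x) → ¬ True x
True-not⁻ {false} _ ()

≮⇒True-not-<ᵇ : ∀ {m n} → ¬ m < n → True (not (m <ᵇ n))
≮⇒True-not-<ᵇ {m} {n} m≮n = True-not⁺ (m≮n ∘ <ᵇ⇒< m n)

<⇒<ᵇ≡true : ∀ {m n} → m < n → (m <ᵇ n) ≡ true
<⇒<ᵇ≡true = Equivalence.to T-≡ ∘ <⇒<ᵇ

≮⇒<ᵇ≡false : ∀ {m n} → ¬ m < n → (m <ᵇ n) ≡ false
≮⇒<ᵇ≡false {m} {n} m≮n with m <ᵇ n in eq
... | false = refl
... | true  = contradiction (<ᵇ⇒< m n (subst True (sym eq) tt)) m≮n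

InRange : ℕ → ℕ → Set
InRange n m = 0 < m × m ≤ n

∈-range1⁺ : ∀ {n m} → InRange n m → m ∈ range1 n
∈-range1⁺ {m = suc m} (_ , m<n) = ∈-applyUpTo⁺ suc m<n

∈-range1⁻ : ∀ {n m} → m ∈ range1 n → InRange n m
∈-range1⁻ m∈ with _ , i<n , refl ← ∈-applyUpTo⁻ suc m∈ = z<s , i<n

Unique-range1 : ∀ n → Unique (range1 n)
Unique-range1 n = Unique.applyUpTo⁺₁ suc n (λ i<j _ → <⇒≢ (s<s i<j))

record IsPermutation (n : ℕ) (f : ℕ → ℕ) : Set where
  field
    inRange : ∀ {m} → InRange n m → InRange n (f m)
    injective : ∀ {m m′} → InRange n m → InRange n m′ → f m ≡ f m′ → m ≡ m′

open IsPermutation public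

InBox : ℕ → (ℕ → ℕ) → ℕ → ℕ → ℕ → ℕ → ℕ → Set
InBox n f A B C D m = InRange n m × (A < m × m < B) × (C < f m × f m < D)

EmptyBox : ℕ → (ℕ → ℕ) → ℕ → ℕ → ℕ → ℕ → Set
EmptyBox n f A B C D = ∀ m → ¬ InBox n f A B C D m

emptyBoxᵇ : ℕ → (ℕ → ℕ) → ℕ → ℕ → ℕ → ℕ → Bool
emptyBoxᵇ n f A B C D = not (any (λ m → (A <ᵇ m) ∧ (m <ᵇ B) ∧ (C <ᵇ f m) ∧ (f m <ᵇ D)) (range1 n))

emptyBoxᵇ⇒EmptyBox : ∀ {n f A B C D} → True (emptyBoxᵇ n f A B C D) → EmptyBox n f A B C D
emptyBoxᵇ⇒EmptyBox t m (r , (A<m , m<B) , (C<fm , fm<D)) =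
  True-not⁻ t (any⁺ _ (lose (∈-range1⁺ r)
    (True-∧⁺ (<⇒<ᵇ A<m) (True-∧⁺ (<⇒<ᵇ m<B) (True-∧⁺ (<⇒<ᵇ C<fm) (<⇒<ᵇ fm<D))))))

EmptyBox⇒emptyBoxᵇ : ∀ {n f A B C D} → EmptyBox n f A B C D → True (emptyBoxᵇ n f A B C D)
EmptyBox⇒emptyBoxᵇ {n} {f} {A} {B} {C} {D} empty = True-not⁺ (λ t → noWitness (find (any⁻ _ _ t)))
  where
  noWitness : ∄[ m ] m ∈ range1 n × True ((A <ᵇ m) ∧ (m <ᵇ B) ∧ (C <ᵇ f m) ∧ (f m <ᵇ D))
  noWitness (m , m∈ , t) =
    let A<m , t = True-∧⁻ _ t ; m<B , t = True-∧⁻ _ t ; C<fm , fm<D = True-∧⁻ _ t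
    in empty m (∈-range1⁻ m∈ , (<ᵇ⇒< _ _ A<m , <ᵇ⇒< _ _ m<B) , (<ᵇ⇒< _ _ C<fm , <ᵇ⇒< _ _ fm<D))

meshPattern : Bool → List (ℕ × ℕ) → Mesh
meshPattern true  T = mesh p123 (B ++ T)
meshPattern false T = mesh p132 (B ++ T)

low high : Bool → ℕ → ℕ → ℕ
low true  j k = j
low false j k = k
high true  j k = k
high false j k = j

≢-low : ∀ d {j k m} → m ≢ j → m ≢ k → m ≢ low d j k
≢-low true  m≢j m≢k = m≢j
≢-low false m≢j m≢k = m≢k

≢-high : ∀ d {j k m} → m ≢ j → m ≢ k → m ≢ high d j k
≢-high true  m≢j m≢k = m≢k
≢-high false m≢j m≢k = m≢j

Ordered : Bool → (ℕ → ℕ) → ℕ → ℕ → ℕ → Set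
Ordered d f x j k = f x < f (low d j k) × f (low d j k) < f (high d j k)

sortedValues : Bool → (ℕ → ℕ) → ℕ → ℕ → ℕ → List ℕ
sortedValues d f x j k = f x ∷ f (low d j k) ∷ f (high d j k) ∷ []

sort-ordered : ∀ d {f x j k} → Ordered d f x j k → sort (f x ∷ f j ∷ f k ∷ []) ≡ sortedValues d f x j k
sort-ordered true  (x<j , j<k) rewrite <⇒<ᵇ≡true j<k | <⇒<ᵇ≡true x<j = refl
sort-ordered false (x<k , k<j) rewrite ≮⇒<ᵇ≡false (<⇒≯ k<j) | <⇒<ᵇ≡true x<k = refl

-- the order-isomorphism test of isOcc on three indices, without its diagonal comparisons
orderIsoᵇ : Bool → (ℕ → ℕ) → ℕ → ℕ → ℕ → Bool
orderIsoᵇ true f x j k =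
  ((f x <ᵇ f j) ∧ (f x <ᵇ f k)) ∧ ((not (f j <ᵇ f x) ∧ (f j <ᵇ f k)) ∧ (not (f k <ᵇ f x) ∧ not (f k <ᵇ f j)))
orderIsoᵇ false f x j k =
  ((f x <ᵇ f j) ∧ (f x <ᵇ f k)) ∧ ((not (f j <ᵇ f x) ∧ not (f j <ᵇ f k)) ∧ (not (f k <ᵇ f x) ∧ (f k <ᵇ f j)))

orderIsoᵇ⇒Ordered : ∀ d {f x j k} → True (orderIsoᵇ d f x j k) → Ordered d f x j k
orderIsoᵇ⇒Ordered true {f} {x} {j} {k} t =
  let l , r = True-∧⁻ ((f x <ᵇ f j) ∧ (f x <ᵇ f k)) t
      x<j , _ = True-∧⁻ (f x <ᵇ f j) l
      _ , j<k = True-∧⁻ (not (f j <ᵇ f x)) (proj₁ (True-∧⁻ (not (f j <ᵇ f x) ∧ (f j <ᵇ f k)) r))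
  in <ᵇ⇒< _ _ x<j , <ᵇ⇒< _ _ j<k
orderIsoᵇ⇒Ordered false {f} {x} {j} {k} t =
  let l , r = True-∧⁻ ((f x <ᵇ f j) ∧ (f x <ᵇ f k)) t
      _ , x<k = True-∧⁻ (f x <ᵇ f j) l
      _ , k<j = True-∧⁻ (not (f k <ᵇ f x)) (proj₂ (True-∧⁻ (not (f j <ᵇ f x) ∧ not (f j <ᵇ f k)) r))
  in <ᵇ⇒< _ _ x<k , <ᵇ⇒< _ _ k<j

Ordered⇒orderIsoᵇ : ∀ d {f x j k} → Ordered d f x j k → True (orderIsoᵇ d f x j k)
Ordered⇒orderIsoᵇ true (x<j , j<k) =
  True-∧⁺ (True-∧⁺ (<⇒<ᵇ x<j) (<⇒<ᵇ x<k))
       (True-∧⁺ (True-∧⁺ (≮⇒True-not-<ᵇ (<⇒≯ x<j)) (<⇒<ᵇ j<k)) (True-∧⁺ (≮⇒True-not-<ᵇ (<⇒≯ x<k)) (≮⇒True-not-<ᵇ (<⇒≯ j<k))))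
  where x<k = <-trans x<j j<k
Ordered⇒orderIsoᵇ false (x<k , k<j) =
  True-∧⁺ (True-∧⁺ (<⇒<ᵇ x<j) (<⇒<ᵇ x<k))
       (True-∧⁺ (True-∧⁺ (≮⇒True-not-<ᵇ (<⇒≯ x<j)) (≮⇒True-not-<ᵇ (<⇒≯ k<j))) (True-∧⁺ (≮⇒True-not-<ᵇ (<⇒≯ x<k)) (<⇒<ᵇ k<j)))
  where x<j = <-trans x<k k<j

bounds : ℕ → List ℕ → List ℕ
bounds n xs = 0 ∷ xs ++ suc n ∷ []

record Cell (n : ℕ) (f : ℕ → ℕ) (is vs : List ℕ) (c : ℕ × ℕ) : Set where
  constructor cell
  field
    empty : EmptyBox n f (at₀ (bounds n is) (proj₁ c)) (at₀ (bounds n is) (suc (proj₁ c)))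
                         (at₀ (bounds n vs) (proj₂ c)) (at₀ (bounds n vs) (suc (proj₂ c)))

cellᵇ : ℕ → (ℕ → ℕ) → List ℕ → List ℕ → ℕ × ℕ → Bool
cellᵇ n f is vals (a , b) = emptyBoxᵇ n f (at₀ (bounds n is) a) (at₀ (bounds n is) (suc a)) (at₀ vs b) (at₀ vs (suc b))
  where vs = bounds n (sort vals)

isOcc-unfold : ∀ d T π x j k → let f = at π in
  isOcc (meshPattern d T) π (x ∷ j ∷ k ∷ []) ≡
  orderIsoᵇ d f x j k ∧ all (cellᵇ (length π) f (x ∷ j ∷ k ∷ []) (f x ∷ f j ∷ f k ∷ [])) (B ++ T)
isOcc-unfold true T π x j k
  rewrite ≮⇒<ᵇ≡false (n≮n (at π x)) | ≮⇒<ᵇ≡false (n≮n (at π j)) | ≮⇒<ᵇ≡false (n≮n (at π k))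
  with at π x <ᵇ at π j | at π x <ᵇ at π k | at π j <ᵇ at π x | at π j <ᵇ at π k | at π k <ᵇ at π x | at π k <ᵇ at π j
... | false | _     | _     | _     | _     | _     = refl
... | true  | false | _     | _     | _     | _     = refl
... | true  | true  | true  | _     | _     | _     = refl
... | true  | true  | false | false | _     | _     = refl
... | true  | true  | false | true  | true  | _     = refl
... | true  | true  | false | true  | false | true  = refl
... | true  | true  | false | true  | false | false = refl
isOcc-unfold false T π x j k
  rewrite ≮⇒<ᵇ≡false (n≮n (at π x)) | ≮⇒<ᵇ≡false (n≮n (at π j)) | ≮⇒<ᵇ≡false (n≮n (at π k))
  with at π x <ᵇ at π j | at π x <ᵇ at π k | at π j <ᵇ at π x | at π j <ᵇ at π k | at π k <ᵇ at π x | at π k <ᵇ at π j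
... | false | _     | _     | _     | _     | _     = refl
... | true  | false | _     | _     | _     | _     = refl
... | true  | true  | true  | _     | _     | _     = refl
... | true  | true  | false | true  | _     | _     = refl
... | true  | true  | false | false | true  | _     = refl
... | true  | true  | false | false | false | false = refl
... | true  | true  | false | false | false | true  = refl

cellᵇ⇒Cell : ∀ {n f is vals vs c} → sort vals ≡ vs → True (cellᵇ n f is vals c) → Cell n f is vs c
cellᵇ⇒Cell {c = a , b} refl t = cell (emptyBoxᵇ⇒EmptyBox t)

Cell⇒cellᵇ : ∀ {n f is vals vs c} → sort vals ≡ vs → Cell n f is vs c → True (cellᵇ n f is vals c)
Cell⇒cellᵇ {c = a , b} refl (cell empty) = EmptyBox⇒emptyBoxᵇ empty

cellsᵇ⇒Cells : ∀ {n f} is vals {vs} R → sort vals ≡ vs → True (all (cellᵇ n f is vals) R) → All (Cell n f is vs) R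
cellsᵇ⇒Cells is vals R eq t = All.map (λ {c} → cellᵇ⇒Cell {is = is} {vals} {c = c} eq) (all⁺ _ R t)

Cells⇒cellsᵇ : ∀ {n f} is vals {vs R} → sort vals ≡ vs → All (Cell n f is vs) R → True (all (cellᵇ n f is vals) R)
Cells⇒cellsᵇ is vals eq cs = all⁻ _ (All.map (λ {c} → Cell⇒cellᵇ {is = is} {vals} {c = c} eq) cs)

data Inner : Set where
  one two three : Inner

⟦_⟧ : Inner → ℕ
⟦ one ⟧   = 1
⟦ two ⟧   = 2
⟦ three ⟧ = 3

⟦⟧∈ : ∀ a → ⟦ a ⟧ ∈ 1 ∷ 2 ∷ 3 ∷ []
⟦⟧∈ one   = here refl
⟦⟧∈ two   = there (here refl)
⟦⟧∈ three = there (there (here refl))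

∈B : ∀ a b → (⟦ a ⟧ , ⟦ b ⟧) ∈ B
∈B a b = concatMap⁺ (λ a → map (a ,_) (1 ∷ 2 ∷ 3 ∷ [])) (Any.map (λ { refl → ∈-map⁺ (⟦ a ⟧ ,_) (⟦⟧∈ b) }) (⟦⟧∈ a))

-- serves both for the columns (positions) and for the rows (values) of a cell
InGap : ℕ → ℕ → ℕ → ℕ → Inner → ℕ → Set
InGap u v w n a y = at₀ gaps ⟦ a ⟧ < y × y < at₀ gaps (suc ⟦ a ⟧)
  where gaps = 0 ∷ u ∷ v ∷ w ∷ suc n ∷ []

inGap : ∀ {u v w n y} → v < w → u < y → y ≤ n → y ≢ v → y ≢ w → ∃[ a ] InGap u v w n a y
inGap {v = v} {w} {y = y} v<w u<y y≤n y≢v y≢w with <-cmp y v | <-cmp y w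
... | tri< y<v _ _ | _            = one , u<y , y<v
... | tri≈ _ y≡v _ | _            = contradiction y≡v y≢v
... | tri> _ _ v<y | tri< y<w _ _ = two , v<y , y<w
... | tri> _ _ _   | tri≈ _ y≡w _ = contradiction y≡w y≢w
... | tri> _ _ _   | tri> _ _ w<y = three , w<y , s≤s y≤n

inGap⁻ : ∀ {u v w n y} a → u < v → v < w → InGap u v w n a y → u < y × y ≢ v × y ≢ w
inGap⁻ one   u<v v<w (u<y , y<v) = u<y , <⇒≢ y<v , <⇒≢ (<-trans y<v v<w)
inGap⁻ two   u<v v<w (v<y , y<w) = <-trans u<v v<y , >⇒≢ v<y , <⇒≢ y<w
inGap⁻ three u<v v<w (w<y , _)   = <-trans (<-trans u<v v<w) w<y , >⇒≢ (<-trans v<w w<y) , >⇒≢ w<y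

low-inRange : ∀ d {n j k} → InRange n j → InRange n k → InRange n (low d j k)
low-inRange true  j∈ k∈ = j∈
low-inRange false j∈ k∈ = k∈

high-inRange : ∀ d {n j k} → InRange n j → InRange n k → InRange n (high d j k)
high-inRange true  j∈ k∈ = k∈
high-inRange false j∈ k∈ = j∈

module _ {n x j k : ℕ} (0<x : 0 < x) (x<j : x < j) (j<k : j < k) (k≤n : k ≤ n) where

  x-inRange : InRange n x
  x-inRange = 0<x , <⇒≤ (<-trans x<j (<-≤-trans j<k k≤n))

  j-inRange : InRange n j
  j-inRange = <-trans 0<x x<j , <⇒≤ (<-≤-trans j<k k≤n)

  k-inRange : InRange n k
  k-inRange = <-trans 0<x (<-trans x<j j<k) , k≤n

Ordered⇒above : ∀ d {f x j k} → Ordered d f x j k → f x < f j × f x < f k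
Ordered⇒above true  (x<j , j<k) = x<j , <-trans x<j j<k
Ordered⇒above false (x<k , k<j) = <-trans x<k k<j , x<k

record Occ (d : Bool) (T : List (ℕ × ℕ)) (n : ℕ) (f : ℕ → ℕ) (x j k : ℕ) : Set where
  field
    0<x : 0 < x
    x<j : x < j
    j<k : j < k
    k≤n : k ≤ n
    ordered : Ordered d f x j k
    -- for permutations, equivalent to the emptiness of the boxes in B (module CellsB)
    belowRoot : ∀ m → InRange n m → x < m → m ≢ j → m ≢ k → f m < f x
    cellsT : All (Cell n f (x ∷ j ∷ k ∷ []) (sortedValues d f x j k)) T

  x∈ : InRange n x
  x∈ = x-inRange 0<x x<j j<k k≤n

  j∈ : InRange n j
  j∈ = j-inRange 0<x x<j j<k k≤n

  k∈ : InRange n k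
  k∈ = k-inRange 0<x x<j j<k k≤n

  above : f x < f j × f x < f k
  above = Ordered⇒above d {f} ordered

  aboveRoot : ∀ m → InRange n m → x < m → f x < f m → m ≡ j ⊎ m ≡ k
  aboveRoot m m∈ x<m fx<fm with m ≟ j | m ≟ k
  ... | yes m≡j | _       = inj₁ m≡j
  ... | no _    | yes m≡k = inj₂ m≡k
  ... | no m≢j  | no m≢k  = contradiction fx<fm (<⇒≯ (belowRoot m m∈ x<m m≢j m≢k))

module CellsB {d n f x j k} (0<x : 0 < x) (x<j : x < j) (j<k : j < k) (k≤n : k ≤ n)
              (ord : Ordered d f x j k) where

  CellsB : Set
  CellsB = ∀ a b → Cell n f (x ∷ j ∷ k ∷ []) (sortedValues d f x j k) (⟦ a ⟧ , ⟦ b ⟧)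

  belowRoot⇒cellsB : (∀ m → InRange n m → x < m → m ≢ j → m ≢ k → f m < f x) → CellsB
  belowRoot⇒cellsB below a b = cell λ m (r , column , row) →
    let x<m , m≢j , m≢k = inGap⁻ a x<j j<k column
    in <-asym (below m r x<m m≢j m≢k) (proj₁ (inGap⁻ b (proj₁ ord) (proj₂ ord) row))

  private
    low∈ = low-inRange d (j-inRange 0<x x<j j<k k≤n) (k-inRange 0<x x<j j<k k≤n)
    high∈ = high-inRange d (j-inRange 0<x x<j j<k k≤n) (k-inRange 0<x x<j j<k k≤n)

  cellsB⇒belowRoot : IsPermutation n f → CellsB → ∀ m → InRange n m → x < m → m ≢ j → m ≢ k → f m < f x
  cellsB⇒belowRoot P cells m r x<m m≢j m≢k with <-cmp (f m) (f x)
  ... | tri< fm<fx _ _ = fm<fx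
  ... | tri≈ _ fm≡fx _ = contradiction (injective P r (x-inRange 0<x x<j j<k k≤n) fm≡fx) (>⇒≢ x<m)
  ... | tri> _ _ fx<fm
    with a , column ← inGap j<k x<m (proj₂ r) m≢j m≢k
       | b , row ← inGap (proj₂ ord) fx<fm (proj₂ (inRange P r)) (≢-low d m≢j m≢k ∘ injective P r low∈)
                                                               (≢-high d m≢j m≢k ∘ injective P r high∈)
    = ⊥-elim (Cell.empty (cells a b) m (r , column , row))

Occ⇒isOcc : ∀ d T π {x j k} → Occ d T (length π) (at π) x j k → True (isOcc (meshPattern d T) π (x ∷ j ∷ k ∷ []))
Occ⇒isOcc d T π {x} {j} {k} o = subst True (sym (isOcc-unfold d T π x j k))
  (True-∧⁺ (Ordered⇒orderIsoᵇ d ordered)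
          (Cells⇒cellsᵇ (x ∷ j ∷ k ∷ []) (at π x ∷ at π j ∷ at π k ∷ []) (sort-ordered d {at π} ordered) (++⁺ cellsB cellsT)))
  where
  open Occ o
  open CellsB {d} {length π} {at π} 0<x x<j j<k k≤n ordered
  cellsB : All (Cell (length π) (at π) (x ∷ j ∷ k ∷ []) (sortedValues d (at π) x j k)) B
  cellsB = let c = belowRoot⇒cellsB belowRoot in
    c one one ∷ c one two ∷ c one three ∷ c two one ∷ c two two ∷ c two three ∷ c three one ∷ c three two ∷ c three three ∷ []

isOcc⇒Occ : ∀ d T π {x j k} → IsPermutation (length π) (at π) → 0 < x → x < j → j < k → k ≤ length π →
            True (isOcc (meshPattern d T) π (x ∷ j ∷ k ∷ [])) → Occ d T (length π) (at π) x j k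
isOcc⇒Occ d T π {x} {j} {k} P 0<x x<j j<k k≤n t = record
  { 0<x = 0<x ; x<j = x<j ; j<k = j<k ; k≤n = k≤n ; ordered = ord
  ; belowRoot = cellsB⇒belowRoot P (λ a b → All.lookup cellsB (∈B a b))
  ; cellsT = cellsT }
  where
  t′ = subst True (isOcc-unfold d T π x j k) t
  ord = orderIsoᵇ⇒Ordered d (proj₁ (True-∧⁻ (orderIsoᵇ d (at π) x j k) t′))
  open CellsB {d} {length π} {at π} 0<x x<j j<k k≤n ord
  cellsBT = cellsᵇ⇒Cells (x ∷ j ∷ k ∷ []) (at π x ∷ at π j ∷ at π k ∷ []) (B ++ T) (sort-ordered d {at π} ord)
              (proj₂ (True-∧⁻ (orderIsoᵇ d (at π) x j k) t′))
  cellsB = proj₁ (++⁻ B cellsBT)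
  cellsT = proj₂ (++⁻ B cellsBT)

Occ-samePair : ∀ {d d′ T T′ n f x j k j′ k′} → Occ d T n f x j k → Occ d′ T′ n f x j′ k′ → j ≡ j′ × k ≡ k′
Occ-samePair o o′ with Occ.aboveRoot o _ (Occ.j∈ o′) (Occ.x<j o′) (proj₁ (Occ.above o′))
                     | Occ.aboveRoot o _ (Occ.k∈ o′) (<-trans (Occ.x<j o′) (Occ.j<k o′)) (proj₂ (Occ.above o′))
... | inj₁ refl | inj₂ refl = refl , refl
... | inj₁ refl | inj₁ refl = contradiction (Occ.j<k o′) (<-irrefl refl)
... | inj₂ refl | inj₂ refl = contradiction (Occ.j<k o′) (<-irrefl refl)
... | inj₂ refl | inj₁ refl = contradiction (Occ.j<k o) (<-asym (Occ.j<k o′))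

Occ-sameMiddle : ∀ {d d′ T T′ n f x x′ a k b} → Occ d T n f x a k → Occ d′ T′ n f x′ a b → k ≡ b
Occ-sameMiddle {f = f} {k = k} {b = b} o o′ with k ≟ b
... | yes k≡b = k≡b
... | no k≢b = contradiction (<-trans (<-trans fk<fx′ fx′<fb) (<-trans fb<fx fx<fk)) (<-irrefl refl)
  where
  fb<fx = Occ.belowRoot o b (Occ.k∈ o′) (<-trans (Occ.x<j o) (Occ.j<k o′)) (>⇒≢ (Occ.j<k o′)) (k≢b ∘ sym)
  fk<fx′ = Occ.belowRoot o′ k (Occ.k∈ o) (<-trans (Occ.x<j o′) (Occ.j<k o)) (>⇒≢ (Occ.j<k o)) k≢b
  fx′<fb = proj₂ (Occ.above o′)
  fx<fk = proj₂ (Occ.above o)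

-- Swapping the values at two positions

transpose : ℕ → ℕ → ℕ → ℕ
transpose a b m with m ≟ a | m ≟ b
... | yes _ | _     = b
... | no _  | yes _ = a
... | no _  | no _  = m

transpose-a : ∀ a b → transpose a b a ≡ b
transpose-a a b with a ≟ a
... | yes _ = refl
... | no a≢a = contradiction refl a≢a

transpose-b : ∀ {a b} → a ≢ b → transpose a b b ≡ a
transpose-b {a} {b} a≢b with b ≟ a | b ≟ b
... | yes b≡a | _     = contradiction (sym b≡a) a≢b
... | no _    | yes _ = refl
... | no _    | no b≢b = contradiction refl b≢b

transpose-other : ∀ {a b m} → m ≢ a → m ≢ b → transpose a b m ≡ m
transpose-other {a} {b} {m} m≢a m≢b with m ≟ a | m ≟ b
... | yes m≡a | _       = contradiction m≡a m≢a
... | no _    | yes m≡b = contradiction m≡b m≢b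
... | no _    | no _    = refl

transpose-involutive : ∀ a b m → transpose a b (transpose a b m) ≡ m
transpose-involutive a b m with m ≟ a | m ≟ b
... | yes refl | _ with a ≟ b
...   | yes refl = transpose-a a a
...   | no a≢b   = transpose-b a≢b
transpose-involutive a b m | no m≢a | yes refl = transpose-a a m
transpose-involutive a b m | no m≢a | no m≢b = transpose-other m≢a m≢b

transpose-preserves : ∀ (P : ℕ → Set) {a b m} → P a → P b → P m → P (transpose a b m)
transpose-preserves P {a} {b} {m} pa pb pm with m ≟ a | m ≟ b
... | yes _ | _     = pb
... | no _  | yes _ = pa
... | no _  | no _  = pm

EmptyBox-transfer : ∀ {n f g A B C D A′ B′ C′ D′} → EmptyBox n f A B C D →
                    (∀ m → InBox n g A′ B′ C′ D′ m → ∃ (InBox n f A B C D)) → EmptyBox n g A′ B′ C′ D′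
EmptyBox-transfer empty witness m inBox = let m′ , inBox′ = witness m inBox in empty m′ inBox′

EmptyBox-agree : ∀ {n f g A B C D C′ D′} → EmptyBox n f A B C D → C′ ≡ C → D′ ≡ D →
                 (∀ m → InRange n m → A < m → m < B → g m ≡ f m) → EmptyBox n g A B C′ D′
EmptyBox-agree empty refl refl agree = EmptyBox-transfer empty λ m (m∈ , (A<m , m<B) , (C<gm , gm<D)) →
  let gm≡fm = agree m m∈ A<m m<B in m , m∈ , (A<m , m<B) , (subst (_ <_) gm≡fm C<gm , subst (_< _) gm≡fm gm<D)

Swapped : ℕ → (ℕ → ℕ) → (ℕ → ℕ) → ℕ → ℕ → Set
Swapped n f g a b = ∀ {m} → InRange n m → g m ≡ f (transpose a b m)

module Swapped {n f g a b} (S : Swapped n f g a b) (a∈ : InRange n a) (b∈ : InRange n b) where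

  at-a : g a ≡ f b
  at-a = trans (S a∈) (cong f (transpose-a a b))

  at-b : a ≢ b → g b ≡ f a
  at-b a≢b = trans (S b∈) (cong f (transpose-b a≢b))

  elsewhere : ∀ {m} → InRange n m → m ≢ a → m ≢ b → g m ≡ f m
  elsewhere m∈ m≢a m≢b = trans (S m∈) (cong f (transpose-other m≢a m≢b))

  reversed : Swapped n g f a b
  reversed {m} m∈ = sym (trans (S (transpose-preserves (InRange n) a∈ b∈ m∈)) (cong f (transpose-involutive a b m)))

  isPermutation : IsPermutation n f → IsPermutation n g
  isPermutation P = record
    { inRange = λ m∈ → subst (InRange n) (sym (S m∈)) (inRange P (σ∈ m∈))
    ; injective = λ {m} {m′} m∈ m′∈ gm≡gm′ →
        trans (sym (transpose-involutive a b m))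
          (trans (cong (transpose a b) (injective P (σ∈ m∈) (σ∈ m′∈) (trans (sym (S m∈)) (trans gm≡gm′ (S m′∈)))))
                 (transpose-involutive a b m′)) }
    where
    σ∈ : ∀ {m} → InRange n m → InRange n (transpose a b m)
    σ∈ = transpose-preserves (InRange n) a∈ b∈

  EmptyBox-swapInside : ∀ {A B C D} → A < a → a < B → A < b → b < B → EmptyBox n f A B C D → EmptyBox n g A B C D
  EmptyBox-swapInside {A} {B} A<a a<B A<b b<B empty = EmptyBox-transfer empty λ m (m∈ , col , (C<gm , gm<D)) →
    transpose a b m , transpose-preserves (InRange n) a∈ b∈ m∈ ,
    transpose-preserves (λ m → A < m × m < B) (A<a , a<B) (A<b , b<B) col ,
    (subst (_ <_) (S m∈) C<gm , subst (_< _) (S m∈) gm<D)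

  EmptyBox-away : ∀ {A B C D} → (∀ {m} → A < m → m < B → m ≢ a × m ≢ b) → EmptyBox n f A B C D → EmptyBox n g A B C D
  EmptyBox-away avoid empty =
    EmptyBox-agree empty refl refl λ m m∈ A<m m<B → let m≢a , m≢b = avoid A<m m<B in elsewhere m∈ m≢a m≢b

  EmptyBox-swapAbove : ∀ {A B C D} → D ≤ f b → (∀ {m} → A < m → m < B → m ≢ b) → EmptyBox n f A B C D → EmptyBox n g A B C D
  EmptyBox-swapAbove {A} {B} {C} {D} D≤fb avoid-b empty = EmptyBox-transfer empty witness
    where
    witness : ∀ m → InBox n g A B C D m → ∃ (InBox n f A B C D)
    witness m (m∈ , (A<m , m<B) , (C<gm , gm<D)) with m ≟ a
    ... | yes refl = contradiction (subst (_< D) at-a gm<D) (≤⇒≯ D≤fb)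
    ... | no m≢a   = let gm≡fm = elsewhere m∈ m≢a (avoid-b A<m m<B) in
      m , m∈ , (A<m , m<B) , (subst (C <_) gm≡fm C<gm , subst (_< D) gm≡fm gm<D)

  EmptyBox-swapBelow : ∀ {A B v} → IsPermutation n f → f a < v → f b < v → EmptyBox n f A B 0 v → EmptyBox n g A B 0 v
  EmptyBox-swapBelow {v = v} P fa<v fb<v empty =
    EmptyBox-transfer empty λ m (m∈ , col , (_ , gm<v)) → m , m∈ , col , (proj₁ (inRange P m∈) , fm<v m∈ gm<v)
    where
    fm<v : ∀ {m} → InRange n m → g m < v → f m < v
    fm<v {m} m∈ gm<v with m ≟ a | m ≟ b
    ... | yes refl | _        = fa<v
    ... | no _     | yes refl = fb<v
    ... | no m≢a   | no m≢b   = subst (_< v) (elsewhere m∈ m≢a m≢b) gm<v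

module _ {f g : ℕ → ℕ} {x j k x′ j′ k′ : ℕ} (gx′ : g x′ ≡ f x) (gj′ : g j′ ≡ f j) (gk′ : g k′ ≡ f k) where

  Ordered-transfer : ∀ d → Ordered d f x j k → Ordered d g x′ j′ k′
  Ordered-transfer true  ord rewrite gx′ | gj′ | gk′ = ord
  Ordered-transfer false ord rewrite gx′ | gj′ | gk′ = ord

  sortedValues-transfer : ∀ d → sortedValues d g x′ j′ k′ ≡ sortedValues d f x j k
  sortedValues-transfer true  rewrite gx′ | gj′ | gk′ = refl
  sortedValues-transfer false rewrite gx′ | gj′ | gk′ = refl

Ordered-not : ∀ d {f x j k} → Ordered d f x k j → Ordered (not d) f x j k
Ordered-not true  ord = ord
Ordered-not false ord = ord

sortedValues-not : ∀ d {f x j k} → sortedValues (not d) f x j k ≡ sortedValues d f x k j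
sortedValues-not true  = refl
sortedValues-not false = refl

data HookCell : ℕ × ℕ → Set where
  c00 : HookCell (0 , 0)
  c01 : HookCell (0 , 1)
  c02 : HookCell (0 , 2)
  c10 : HookCell (1 , 0)
  c20 : HookCell (2 , 0)

Cells-transfer : ∀ {T n f g is is′ vs vs′ vs″} → All HookCell T → vs″ ≡ vs′ →
                 (∀ {c} → HookCell c → Cell n f is vs c → Cell n g is′ vs′ c) →
                 All (Cell n f is vs) T → All (Cell n g is′ vs″) T
Cells-transfer hooks refl move cells = All.zipWith (λ (h , c) → move h c) (hooks , cells)

module Flip {n f g} (P : IsPermutation n f) {T} (hooks : All HookCell T)
            {d₀ x₀ a b} (W : Occ d₀ T n f x₀ a b) (S : Swapped n f g a b) where

  private
    module W = Occ W
    x₀<a = W.x<j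
    a<b = W.j<k
    fx₀<fa = proj₁ W.above
    fx₀<fb = proj₂ W.above

  open Swapped {n} {f} {g} S W.j∈ W.k∈

  private
    gb : g b ≡ f a
    gb = at-b (<⇒≢ a<b)

    below-x₀ : ∀ {m} → InRange n m → x₀ < m → m ≢ a → m ≢ b → f m < f x₀
    below-x₀ m∈ = W.belowRoot _ m∈

    before-x₀ : ∀ {m} → InRange n m → m ≢ a → m ≢ b → f x₀ < f m → m < x₀
    before-x₀ {m} m∈ m≢a m≢b fx₀<fm with <-cmp m x₀
    ... | tri< m<x₀ _ _ = m<x₀
    ... | tri≈ _ refl _ = contradiction fx₀<fm (<-irrefl refl)
    ... | tri> _ _ x₀<m = contradiction fx₀<fm (<-asym (below-x₀ m∈ x₀<m m≢a m≢b))

    x₀-inBox : ∀ {A B C D} → A < x₀ → x₀ < B → C < f x₀ → f x₀ < D → ¬ EmptyBox n f A B C D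
    x₀-inBox A<x₀ x₀<B C<fx₀ fx₀<D empty = empty x₀ (W.x∈ , (A<x₀ , x₀<B) , (C<fx₀ , fx₀<D))

    g<g : ∀ {m m′} → g m ≡ f m → g m′ ≡ f m′ → f m < f m′ → g m < g m′
    g<g gm gm′ = subst₂ _<_ (sym gm) (sym gm′)

  flip-middle : ∀ {d x k} → Occ d T n f x a k → Occ (not d) T n g x a b
  flip-middle {d} {x} o with refl ← Occ-sameMiddle o W = record
    { 0<x = o.0<x ; x<j = x<a ; j<k = a<b ; k≤n = o.k≤n
    ; ordered = Ordered-not d {g} (Ordered-transfer {f = f} {g} gx gb at-a d o.ordered)
    ; belowRoot = λ m m∈ x<m m≢a m≢b → g<g (elsewhere m∈ m≢a m≢b) gx (o.belowRoot m m∈ x<m m≢a m≢b)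
    ; cellsT = Cells-transfer hooks (trans (sortedValues-not d {g}) (sortedValues-transfer {f = f} {g} gx gb at-a d)) move o.cellsT }
    where
    module o = Occ o
    x<a = o.x<j
    gx = elsewhere o.x∈ (<⇒≢ x<a) (<⇒≢ (<-trans x<a a<b))
    before-x : ∀ {m} → 0 < m → m < x → m ≢ a × m ≢ b
    before-x _ m<x = <⇒≢ (<-trans m<x x<a) , <⇒≢ (<-trans m<x (<-trans x<a a<b))
    move : ∀ {c vs} → HookCell c → Cell n f (x ∷ a ∷ b ∷ []) vs c → Cell n g (x ∷ a ∷ b ∷ []) vs c
    move c00 (cell e) = cell (EmptyBox-away before-x e)
    move c01 (cell e) = cell (EmptyBox-away before-x e)
    move c02 (cell e) = cell (EmptyBox-away before-x e)
    move c10 (cell e) = cell (EmptyBox-away (λ _ m<a → <⇒≢ m<a , <⇒≢ (<-trans m<a a<b)) e)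
    move c20 (cell e) = cell (EmptyBox-away (λ a<m m<b → >⇒≢ a<m , <⇒≢ m<b) e)

  private
    right-of-b : ∀ {d x s k} → b < x → Occ d T n f x s k → Occ d T n g x s k
    right-of-b {d} {x} {s} {k} b<x o = record
      { 0<x = o.0<x ; x<j = o.x<j ; j<k = o.j<k ; k≤n = o.k≤n
      ; ordered = Ordered-transfer {f = f} {g} gx gs gk d o.ordered
      ; belowRoot = λ m m∈ x<m m≢s m≢k → g<g (unchanged m∈ (<⇒≤ x<m)) gx (o.belowRoot m m∈ x<m m≢s m≢k)
      ; cellsT = Cells-transfer hooks (sortedValues-transfer {f = f} {g} gx gs gk d) move o.cellsT }
      where
      module o = Occ o
      a<x = <-trans a<b b<x
      unchanged : ∀ {m} → InRange n m → x ≤ m → g m ≡ f m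
      unchanged m∈ x≤m = elsewhere m∈ (>⇒≢ (<-≤-trans a<x x≤m)) (>⇒≢ (<-≤-trans b<x x≤m))
      gx = unchanged o.x∈ ≤-refl
      gs = unchanged o.j∈ (<⇒≤ o.x<j)
      gk = unchanged o.k∈ (<⇒≤ (<-trans o.x<j o.j<k))
      after-x : ∀ {A m B} → x ≤ A → A < m → m < B → m ≢ a × m ≢ b
      after-x x≤A A<m _ = >⇒≢ (<-trans a<x (≤-<-trans x≤A A<m)) , >⇒≢ (<-trans b<x (≤-<-trans x≤A A<m))
      swapLeft : ∀ {C D} → EmptyBox n f 0 x C D → EmptyBox n g 0 x C D
      swapLeft = EmptyBox-swapInside (proj₁ W.j∈) a<x (proj₁ W.k∈) b<x
      move : ∀ {c vs} → HookCell c → Cell n f (x ∷ s ∷ k ∷ []) vs c → Cell n g (x ∷ s ∷ k ∷ []) vs c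
      move c00 (cell e) = cell (swapLeft e)
      move c01 (cell e) = cell (swapLeft e)
      move c02 (cell e) = cell (swapLeft e)
      move c10 (cell e) = cell (EmptyBox-away (after-x ≤-refl) e)
      move c20 (cell e) = cell (EmptyBox-away (after-x (<⇒≤ o.x<j)) e)

    rooted-at-a : ∀ {d s k} → ¬ Occ d T n f a s k
    rooted-at-a o = <-irrefl (trans (is-b o.j∈ o.x<j (proj₁ o.above)) (sym (is-b o.k∈ (<-trans o.x<j o.j<k) (proj₂ o.above)))) o.j<k
      where
      module o = Occ o
      is-b : ∀ {m} → InRange n m → a < m → f a < f m → m ≡ b
      is-b {m} m∈ a<m fa<fm with m ≟ b
      ... | yes m≡b = m≡b
      ... | no m≢b = contradiction (<-trans fx₀<fa fa<fm) (<-asym (below-x₀ m∈ (<-trans x₀<a a<m) (>⇒≢ a<m) m≢b))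

    rooted-at-b : ∀ {d s k} → ¬ Occ d T n f b s k
    rooted-at-b o = contradiction (<-trans fx₀<fb (proj₁ o.above))
      (<-asym (below-x₀ o.j∈ (<-trans (<-trans x₀<a a<b) o.x<j) (>⇒≢ (<-trans a<b o.x<j)) (>⇒≢ o.x<j)))
      where module o = Occ o

    between-b-middle : ∀ {d x k} → a < x → Occ d T n f x b k → Occ d T n g x b k
    between-b-middle {true} a<x o = ⊥-elim (<-asym (proj₂ o.ordered) (<-trans fk<fx₀ fx₀<fb))
      where
      module o = Occ o
      fk<fx₀ = below-x₀ o.k∈ (<-trans (<-trans x₀<a a<b) o.j<k) (>⇒≢ (<-trans a<b o.j<k)) (>⇒≢ o.j<k)
    between-b-middle {false} {x} {k} a<x o = record
      { 0<x = o.0<x ; x<j = o.x<j ; j<k = o.j<k ; k≤n = o.k≤n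
      ; ordered = g<g gx gk (proj₁ o.ordered) , subst₂ _<_ (sym gk) (sym gb) (<-trans fk<fx₀ fx₀<fa)
      ; belowRoot = λ m m∈ x<m m≢b m≢k → g<g (elsewhere m∈ (>⇒≢ (<-trans a<x x<m)) m≢b) gx (o.belowRoot m m∈ x<m m≢b m≢k)
      ; cellsT = Cells-transfer hooks (cong₂ _∷_ gx (cong₂ _∷_ gk (cong (_∷ []) gb))) move o.cellsT }
      where
      module o = Occ o
      b<k = o.j<k
      fk<fx₀ = below-x₀ o.k∈ (<-trans (<-trans x₀<a a<b) b<k) (>⇒≢ (<-trans a<b b<k)) (>⇒≢ b<k)
      gx = elsewhere o.x∈ (>⇒≢ a<x) (<⇒≢ o.x<j)
      gk = elsewhere o.k∈ (>⇒≢ (<-trans a<b b<k)) (>⇒≢ b<k)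
      before-x : ∀ {m} → 0 < m → m < x → m ≢ b
      before-x _ m<x = <⇒≢ (<-trans m<x o.x<j)
      move : ∀ {c} → HookCell c → Cell n f (x ∷ b ∷ k ∷ []) (f x ∷ f k ∷ f b ∷ []) c
                                → Cell n g (x ∷ b ∷ k ∷ []) (f x ∷ f k ∷ f a ∷ []) c
      move c00 (cell e) = cell (EmptyBox-swapAbove (<⇒≤ (proj₁ (Occ.above o))) before-x e)
      move c01 (cell e) = cell (EmptyBox-swapAbove (<⇒≤ (<-trans fk<fx₀ fx₀<fb)) before-x e)
      move c02 (cell e) = ⊥-elim (x₀-inBox (proj₁ W.x∈) (<-trans x₀<a a<x) fk<fx₀ fx₀<fb e)
      move c10 (cell e) = cell (EmptyBox-away (λ x<m m<b → >⇒≢ (<-trans a<x x<m) , <⇒≢ m<b) e)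
      move c20 (cell e) = cell (EmptyBox-away (λ b<m _ → >⇒≢ (<-trans a<b b<m) , >⇒≢ b<m) e)

    between-b-last : ∀ {d x s} → a < x → s ≢ a → Occ d T n f x s b → Occ d T n g x s b
    between-b-last {false} a<x s≢a o = ⊥-elim (<-asym (proj₂ o.ordered) (<-trans fs<fx₀ fx₀<fb))
      where
      module o = Occ o
      fs<fx₀ = below-x₀ o.j∈ (<-trans (<-trans x₀<a a<x) o.x<j) s≢a (<⇒≢ o.j<k)
    between-b-last {true} {x} {s} a<x s≢a o = record
      { 0<x = o.0<x ; x<j = o.x<j ; j<k = o.j<k ; k≤n = o.k≤n
      ; ordered = g<g gx gs (proj₁ o.ordered) , subst₂ _<_ (sym gs) (sym gb) (<-trans fs<fx₀ fx₀<fa)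
      ; belowRoot = λ m m∈ x<m m≢s m≢b → g<g (elsewhere m∈ (>⇒≢ (<-trans a<x x<m)) m≢b) gx (o.belowRoot m m∈ x<m m≢s m≢b)
      ; cellsT = Cells-transfer hooks (cong₂ _∷_ gx (cong₂ _∷_ gs (cong (_∷ []) gb))) move o.cellsT }
      where
      module o = Occ o
      x<s = o.x<j
      s<b = o.j<k
      fs<fx₀ = below-x₀ o.j∈ (<-trans (<-trans x₀<a a<x) x<s) s≢a (<⇒≢ s<b)
      gx = elsewhere o.x∈ (>⇒≢ a<x) (<⇒≢ (<-trans x<s s<b))
      gs = elsewhere o.j∈ s≢a (<⇒≢ s<b)
      before-x : ∀ {m} → 0 < m → m < x → m ≢ b
      before-x _ m<x = <⇒≢ (<-trans m<x (<-trans x<s s<b))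
      move : ∀ {c} → HookCell c → Cell n f (x ∷ s ∷ b ∷ []) (f x ∷ f s ∷ f b ∷ []) c
                                → Cell n g (x ∷ s ∷ b ∷ []) (f x ∷ f s ∷ f a ∷ []) c
      move c00 (cell e) = cell (EmptyBox-swapAbove (<⇒≤ (proj₂ (Occ.above o))) before-x e)
      move c01 (cell e) = cell (EmptyBox-swapAbove (<⇒≤ (<-trans fs<fx₀ fx₀<fb)) before-x e)
      move c02 (cell e) = ⊥-elim (x₀-inBox (proj₁ W.x∈) (<-trans x₀<a a<x) fs<fx₀ fx₀<fb e)
      move c10 (cell e) = cell (EmptyBox-away (λ x<m m<s → >⇒≢ (<-trans a<x x<m) , <⇒≢ (<-trans m<s s<b)) e)
      move c20 (cell e) = cell (EmptyBox-away (λ s<m m<b → >⇒≢ (<-trans (<-trans a<x x<s) s<m) , <⇒≢ m<b) e)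

    left-below-both : ∀ {d x s k} → x < a → f a < f x → f b < f x → Occ d T n f x s k → Occ d T n g x s k
    left-below-both {d} {x} {s} {k} x<a fa<fx fb<fx o = record
      { 0<x = o.0<x ; x<j = o.x<j ; j<k = o.j<k ; k≤n = o.k≤n
      ; ordered = Ordered-transfer {f = f} {g} gx gs gk d o.ordered
      ; belowRoot = below
      ; cellsT = Cells-transfer hooks (sortedValues-transfer {f = f} {g} gx gs gk d) move o.cellsT }
      where
      module o = Occ o
      x<b = <-trans x<a a<b
      gx = elsewhere o.x∈ (<⇒≢ x<a) (<⇒≢ x<b)
      above-x-unchanged : ∀ {m} → InRange n m → f x < f m → g m ≡ f m
      above-x-unchanged m∈ fx<fm = elsewhere m∈ (λ { refl → <-asym fx<fm fa<fx }) (λ { refl → <-asym fx<fm fb<fx })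
      gs = above-x-unchanged o.j∈ (proj₁ o.above)
      gk = above-x-unchanged o.k∈ (proj₂ o.above)
      below : ∀ m → InRange n m → x < m → m ≢ s → m ≢ k → g m < g x
      below m m∈ x<m m≢s m≢k with m ≟ a | m ≟ b
      ... | yes refl | _        = subst₂ _<_ (sym at-a) (sym gx) fb<fx
      ... | no _     | yes refl = subst₂ _<_ (sym gb) (sym gx) fa<fx
      ... | no m≢a   | no m≢b   = g<g (elsewhere m∈ m≢a m≢b) gx (o.belowRoot m m∈ x<m m≢s m≢k)
      before-x : ∀ {m} → 0 < m → m < x → m ≢ a × m ≢ b
      before-x _ m<x = <⇒≢ (<-trans m<x x<a) , <⇒≢ (<-trans m<x x<b)
      move : ∀ {c} → HookCell c → Cell n f (x ∷ s ∷ k ∷ []) (sortedValues d f x s k) c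
                                → Cell n g (x ∷ s ∷ k ∷ []) (sortedValues d f x s k) c
      move c00 (cell e) = cell (EmptyBox-away before-x e)
      move c01 (cell e) = cell (EmptyBox-away before-x e)
      move c02 (cell e) = cell (EmptyBox-away before-x e)
      move c10 (cell e) = cell (EmptyBox-swapBelow P fa<fx fb<fx e)
      move c20 (cell e) = cell (EmptyBox-swapBelow P fa<fx fb<fx e)

    left-partner-b : ∀ {d x s} → x < a → s ≢ a → f a < f x → Occ d T n f x s b → Occ d T n g x s a
    left-partner-b {d} {x} {s} x<a s≢a fa<fx o = record
      { 0<x = o.0<x ; x<j = o.x<j ; j<k = <-trans s<x₀ x₀<a ; k≤n = proj₂ W.j∈
      ; ordered = Ordered-transfer {f = f} {g} gx gs at-a d o.ordered
      ; belowRoot = below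
      ; cellsT = Cells-transfer hooks (sortedValues-transfer {f = f} {g} gx gs at-a d) move o.cellsT }
      where
      module o = Occ o
      x<b = <-trans x<a a<b
      s≢b = <⇒≢ o.j<k
      s<x₀ = before-x₀ o.j∈ s≢a s≢b (<-trans (<-trans fx₀<fa fa<fx) (proj₁ o.above))
      gx = elsewhere o.x∈ (<⇒≢ x<a) (<⇒≢ x<b)
      gs = elsewhere o.j∈ s≢a s≢b
      below : ∀ m → InRange n m → x < m → m ≢ s → m ≢ a → g m < g x
      below m m∈ x<m m≢s m≢a with m ≟ b
      ... | yes refl = subst₂ _<_ (sym gb) (sym gx) fa<fx
      ... | no m≢b   = g<g (elsewhere m∈ m≢a m≢b) gx (o.belowRoot m m∈ x<m m≢s m≢b)
      before-x : ∀ {m} → 0 < m → m < x → m ≢ a × m ≢ b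
      before-x _ m<x = <⇒≢ (<-trans m<x x<a) , <⇒≢ (<-trans m<x x<b)
      move : ∀ {c} → HookCell c → Cell n f (x ∷ s ∷ b ∷ []) (sortedValues d f x s b) c
                                → Cell n g (x ∷ s ∷ a ∷ []) (sortedValues d f x s b) c
      move c00 (cell e) = cell (EmptyBox-away before-x e)
      move c01 (cell e) = cell (EmptyBox-away before-x e)
      move c02 (cell e) = cell (EmptyBox-away before-x e)
      move c10 (cell e) = cell (EmptyBox-away (λ _ m<s → <⇒≢ (<-trans m<s (<-trans s<x₀ x₀<a)) ,
                                                        <⇒≢ (<-trans m<s (<-trans s<x₀ (<-trans x₀<a a<b)))) e)
      move c20 (cell e) = ⊥-elim (x₀-inBox s<x₀ (<-trans x₀<a a<b) (proj₁ (inRange P W.x∈)) (<-trans fx₀<fa fa<fx) e)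

    left-partner-a : ∀ {d x s} → x < a → s ≢ a → f b < f x → Occ d T n f x s a → Occ d T n g x s b
    left-partner-a {d} {x} {s} x<a s≢a fb<fx o = record
      { 0<x = o.0<x ; x<j = o.x<j ; j<k = <-trans s<x₀ (<-trans x₀<a a<b) ; k≤n = proj₂ W.k∈
      ; ordered = Ordered-transfer {f = f} {g} gx gs gb d o.ordered
      ; belowRoot = below
      ; cellsT = Cells-transfer hooks (sortedValues-transfer {f = f} {g} gx gs gb d) move o.cellsT }
      where
      module o = Occ o
      x<b = <-trans x<a a<b
      s≢b = <⇒≢ (<-trans o.j<k a<b)
      s<x₀ = before-x₀ o.j∈ s≢a s≢b (<-trans (<-trans fx₀<fb fb<fx) (proj₁ o.above))
      gx = elsewhere o.x∈ (<⇒≢ x<a) (<⇒≢ x<b)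
      gs = elsewhere o.j∈ s≢a s≢b
      below : ∀ m → InRange n m → x < m → m ≢ s → m ≢ b → g m < g x
      below m m∈ x<m m≢s m≢b with m ≟ a
      ... | yes refl = subst₂ _<_ (sym at-a) (sym gx) fb<fx
      ... | no m≢a   = g<g (elsewhere m∈ m≢a m≢b) gx (o.belowRoot m m∈ x<m m≢s m≢a)
      before-x : ∀ {m} → 0 < m → m < x → m ≢ a × m ≢ b
      before-x _ m<x = <⇒≢ (<-trans m<x x<a) , <⇒≢ (<-trans m<x x<b)
      move : ∀ {c} → HookCell c → Cell n f (x ∷ s ∷ a ∷ []) (sortedValues d f x s a) c
                                → Cell n g (x ∷ s ∷ b ∷ []) (sortedValues d f x s a) c
      move c00 (cell e) = cell (EmptyBox-away before-x e)
      move c01 (cell e) = cell (EmptyBox-away before-x e)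
      move c02 (cell e) = cell (EmptyBox-away before-x e)
      move c10 (cell e) = cell (EmptyBox-away (λ _ m<s → <⇒≢ (<-trans m<s (<-trans s<x₀ x₀<a)) ,
                                                        <⇒≢ (<-trans m<s (<-trans s<x₀ (<-trans x₀<a a<b)))) e)
      move c20 (cell e) = ⊥-elim (x₀-inBox s<x₀ x₀<a (proj₁ (inRange P W.x∈)) (<-trans fx₀<fb fb<fx) e)

    between : ∀ {d x s k} → a < x → x < b → s ≢ a → Occ d T n f x s k → ∃[ k′ ] Occ d T n g x s k′
    between {k = k} a<x x<b s≢a o with Occ.aboveRoot o b W.k∈ x<b (<-trans fx<fx₀ fx₀<fb)
      where fx<fx₀ = below-x₀ (Occ.x∈ o) (<-trans x₀<a a<x) (>⇒≢ a<x) (<⇒≢ x<b)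
    ... | inj₁ refl = k , between-b-middle a<x o
    ... | inj₂ refl = b , between-b-last a<x s≢a o

    left-above-both : ∀ {d x s k} → x < a → s ≢ a → f x < f a → f x < f b → ¬ Occ d T n f x s k
    left-above-both x<a s≢a fx<fa fx<fb o
      with Occ.aboveRoot o a W.j∈ x<a fx<fa | Occ.aboveRoot o b W.k∈ (<-trans x<a a<b) fx<fb
    ... | inj₁ a≡s  | _         = s≢a (sym a≡s)
    ... | inj₂ refl | inj₁ refl = <-asym a<b (Occ.j<k o)
    ... | inj₂ refl | inj₂ refl = <-irrefl refl a<b

    left-b-middle : ∀ {d x k} → f a < f x → ¬ Occ d T n f x b k
    left-b-middle fa<fx o = <-asym (proj₂ (Occ.above o)) (<-trans fk<fx₀ (<-trans fx₀<fa fa<fx))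
      where
      b<k = Occ.j<k o
      fk<fx₀ = below-x₀ (Occ.k∈ o) (<-trans (<-trans x₀<a a<b) b<k) (>⇒≢ (<-trans a<b b<k)) (>⇒≢ b<k)

    left-of-a : ∀ {d x s k} → x < a → s ≢ a → Occ d T n f x s k → ∃[ k′ ] Occ d T n g x s k′
    left-of-a {k = k} x<a s≢a o with <-cmp (f a) (f _) | <-cmp (f b) (f _)
    ... | tri≈ _ fa≡fx _ | _ = contradiction (injective P W.j∈ (Occ.x∈ o) fa≡fx) (>⇒≢ x<a)
    ... | _ | tri≈ _ fb≡fx _ = contradiction (injective P W.k∈ (Occ.x∈ o) fb≡fx) (>⇒≢ (<-trans x<a a<b))
    ... | tri< fa<fx _ _ | tri< fb<fx _ _ = k , left-below-both x<a fa<fx fb<fx o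
    ... | tri> _ _ fx<fa | tri> _ _ fx<fb = ⊥-elim (left-above-both x<a s≢a fx<fa fx<fb o)
    ... | tri< fa<fx _ _ | tri> _ _ fx<fb with Occ.aboveRoot o b W.k∈ (<-trans x<a a<b) fx<fb
    ...   | inj₁ refl = ⊥-elim (left-b-middle fa<fx o)
    ...   | inj₂ refl = a , left-partner-b x<a s≢a fa<fx o
    left-of-a x<a s≢a o | tri> _ _ fx<fa | tri< fb<fx _ _ with Occ.aboveRoot o a W.j∈ x<a fx<fa
    ...   | inj₁ a≡s  = contradiction (sym a≡s) s≢a
    ...   | inj₂ refl = b , left-partner-a x<a s≢a fb<fx o

  -- the last point may move: an occurrence with first point left of a and last point a
  -- (resp. b) ends at b (resp. a) after the swap
  keep-other : ∀ {d x s k} → s ≢ a → Occ d T n f x s k → ∃[ k′ ] Occ d T n g x s k′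
  keep-other {x = x} {k = k} s≢a o with <-cmp x a
  ... | tri< x<a _ _ = left-of-a x<a s≢a o
  ... | tri≈ _ refl _ = ⊥-elim (rooted-at-a o)
  ... | tri> _ _ a<x with <-cmp x b
  ...   | tri< x<b _ _ = between a<x x<b s≢a o
  ...   | tri≈ _ refl _ = ⊥-elim (rooted-at-b o)
  ...   | tri> _ _ b<x = k , right-of-b b<x o

OccAt : Bool → List (ℕ × ℕ) → ℕ → (ℕ → ℕ) → ℕ → ℕ → Set
OccAt d T n f x s = ∃[ k ] Occ d T n f x s k

module FlipOccAt {n f g} (P : IsPermutation n f) {T} (hooks : All HookCell T)
                 {d₀ x₀ a b} (W : Occ d₀ T n f x₀ a b) (S : Swapped n f g a b) where

  private
    module W = Occ W
    module F = Flip P hooks W S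

  isPermutation : IsPermutation n g
  isPermutation = Swapped.isPermutation {n} {f} {g} S W.j∈ W.k∈ P

  flipped : Occ (not d₀) T n g x₀ a b
  flipped = F.flip-middle W

  private
    module F⁻¹ = Flip isPermutation hooks flipped (Swapped.reversed {n} {f} {g} S W.j∈ W.k∈)

  occAt-middle : ∀ d x → OccAt d T n g x a ⇔ OccAt (not d) T n f x a
  occAt-middle d x = mk⇔ (λ (_ , o) → b , F⁻¹.flip-middle o)
                         (λ (_ , o) → b , subst (λ d → Occ d T n g x a b) (not-involutive d) (F.flip-middle o))

  occAt-other : ∀ d x s → s ≢ a → OccAt d T n g x s ⇔ OccAt d T n f x s
  occAt-other d x s s≢a = mk⇔ (F⁻¹.keep-other s≢a ∘ proj₂) (F.keep-other s≢a ∘ proj₂)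

-- Swapping at every middle point

at-applyUpTo : ∀ (h : ℕ → ℕ) {n i} → i < n → at (applyUpTo h n) (suc i) ≡ h i
at-applyUpTo h {suc n} {zero}  _   = refl
at-applyUpTo h {suc n} {suc i} i<n = at-applyUpTo (h ∘ suc) (≤-pred i<n)

applyUpTo-at : ∀ π → applyUpTo (λ i → at π (suc i)) (length π) ≡ π
applyUpTo-at []       = refl
applyUpTo-at (x ∷ xs) = cong (x ∷_) (applyUpTo-at xs)

applyUpTo-cong : ∀ {h h′ : ℕ → ℕ} n → (∀ {i} → i < n → h i ≡ h′ i) → applyUpTo h n ≡ applyUpTo h′ n
applyUpTo-cong zero    _  = refl
applyUpTo-cong (suc n) eq = cong₂ _∷_ (eq z<s) (applyUpTo-cong n (eq ∘ s<s))

at-ext : ∀ {π π′} → length π ≡ length π′ → (∀ {m} → InRange (length π) m → at π m ≡ at π′ m) → π ≡ π′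
at-ext {π} {π′} len eq = begin
  π                                                ≡⟨ applyUpTo-at π ⟨
  applyUpTo (λ i → at π (suc i)) (length π)        ≡⟨ applyUpTo-cong (length π) (λ i<n → eq (z<s , i<n)) ⟩
  applyUpTo (λ i → at π′ (suc i)) (length π)       ≡⟨ cong (applyUpTo (λ i → at π′ (suc i))) len ⟩
  applyUpTo (λ i → at π′ (suc i)) (length π′)      ≡⟨ applyUpTo-at π′ ⟩
  π′                                               ∎
  where open ≡-Reasoning

swapValues : List ℕ → ℕ → ℕ → List ℕ
swapValues π a b = applyUpTo (λ i → at π (transpose a b (suc i))) (length π)

length-swapValues : ∀ π a b → length (swapValues π a b) ≡ length π
length-swapValues π a b = length-applyUpTo _ (length π)

swapValues-swapped : ∀ π a b → Swapped (length π) (at π) (at (swapValues π a b)) a b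
swapValues-swapped π a b {suc m} (_ , m<n) = at-applyUpTo (λ i → at π (transpose a b (suc i))) m<n

swapValues-involutive : ∀ π {a b} → InRange (length π) a → InRange (length π) b → swapValues (swapValues π a b) a b ≡ π
swapValues-involutive π {a} {b} a∈ b∈ = at-ext (trans (length-swapValues σ a b) (length-swapValues π a b)) λ {m} m∈ →
  trans (swapValues-swapped σ a b (resize σ m∈))
    (trans (swapValues-swapped π a b (transpose-preserves (InRange _) a∈ b∈ (resize π (resize σ m∈))))
           (cong (at π) (transpose-involutive a b m)))
  where
  σ = swapValues π a b
  resize : ∀ ρ {m} → InRange (length (swapValues ρ a b)) m → InRange (length ρ) m
  resize ρ {m} = subst (λ n → InRange n m) (length-swapValues ρ a b)

record Permutation (n : ℕ) (π : List ℕ) : Set where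
  constructor perm
  field
    length≡ : length π ≡ n
    isPermutation : IsPermutation n (at π)

findᵇ-just : ∀ {A : Set} (p : A → Bool) xs {y} → findᵇ p xs ≡ just y → y ∈ xs × True (p y)
findᵇ-just p (x ∷ xs) eq with p x in px
... | true  with refl ← eq = here refl , subst True (sym px) _
... | false = let y∈ , py = findᵇ-just p xs eq in there y∈ , py

findᵇ-nothing : ∀ {A : Set} (p : A → Bool) xs → findᵇ p xs ≡ nothing → ∀ {y} → y ∈ xs → ¬ True (p y)
findᵇ-nothing p (x ∷ xs) eq y∈ py with p x in px
findᵇ-nothing p (x ∷ xs) eq (here refl) py | false = subst True px py
findᵇ-nothing p (x ∷ xs) eq (there y∈) py | false = findᵇ-nothing p xs eq y∈ py

middleᵇ : List (ℕ × ℕ) → List ℕ → ℕ → ℕ → ℕ → Bool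
middleᵇ T π x a k = (x <ᵇ a) ∧ (a <ᵇ k) ∧ (isOcc (meshPattern true T) π is ∨ isOcc (meshPattern false T) π is)
  where is = x ∷ a ∷ k ∷ []

middleᵇ⇒Occ : ∀ {T} π {x a k} → IsPermutation (length π) (at π) → InRange (length π) x → InRange (length π) k →
              True (middleᵇ T π x a k) → ∃[ d ] Occ d T (length π) (at π) x a k
middleᵇ⇒Occ {T} π {x} {a} {k} P (0<x , _) (_ , k≤n) t
  with x<a , t ← True-∧⁻ (x <ᵇ a) t
  with a<k , t ← True-∧⁻ (a <ᵇ k) t
  with Equivalence.to T-∨ t
... | inj₁ t₁ = true  , isOcc⇒Occ true  T π P 0<x (<ᵇ⇒< x a x<a) (<ᵇ⇒< a k a<k) k≤n t₁
... | inj₂ t₂ = false , isOcc⇒Occ false T π P 0<x (<ᵇ⇒< x a x<a) (<ᵇ⇒< a k a<k) k≤n t₂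

Occ⇒middleᵇ : ∀ d T π {x a k} → Occ d T (length π) (at π) x a k → True (middleᵇ T π x a k)
Occ⇒middleᵇ d T π {x} {a} {k} o =
  True-∧⁺ (<⇒<ᵇ (Occ.x<j o)) (True-∧⁺ (<⇒<ᵇ (Occ.j<k o)) (Equivalence.from T-∨ (isOcc-either d o)))
  where
  isOcc-either : ∀ d → Occ d T (length π) (at π) x a k →
    True (isOcc (meshPattern true T) π (x ∷ a ∷ k ∷ [])) ⊎ True (isOcc (meshPattern false T) π (x ∷ a ∷ k ∷ []))
  isOcc-either true  o = inj₁ (Occ⇒isOcc true T π o)
  isOcc-either false o = inj₂ (Occ⇒isOcc false T π o)

-- opaque, so that the search is only ever used through partner-just and partner-nothing
opaque
  partner : List (ℕ × ℕ) → List ℕ → ℕ → Maybe ℕ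
  partner T π a = findᵇ (λ k → any (λ x → middleᵇ T π x a k) (range1 (length π))) (range1 (length π))

opaque
  unfolding partner

  partner-just : ∀ {T} π {a b} → IsPermutation (length π) (at π) → partner T π a ≡ just b →
                 ∃[ d ] ∃[ x ] Occ d T (length π) (at π) x a b
  partner-just π P eq =
    let b∈ , t = findᵇ-just _ (range1 (length π)) eq
        x , x∈ , t = find (any⁻ _ (range1 (length π)) t)
        d , o = middleᵇ⇒Occ π P (∈-range1⁻ x∈) (∈-range1⁻ b∈) t
    in d , x , o

  partner-nothing : ∀ {d T} π {x a k} → partner T π a ≡ nothing → ¬ Occ d T (length π) (at π) x a k
  partner-nothing {d} {T} π eq o =
    findᵇ-nothing _ (range1 (length π)) eq (∈-range1⁺ (Occ.k∈ o))
      (any⁺ _ (lose (∈-range1⁺ (Occ.x∈ o)) (Occ⇒middleᵇ d T π o)))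

flipAt : List (ℕ × ℕ) → ℕ → List ℕ → List ℕ
flipAt T a π = maybe′ (swapValues π a) π (partner T π a)

record FlipStep (T : List (ℕ × ℕ)) (a n : ℕ) (π σ : List ℕ) : Set where
  field
    permutation : Permutation n σ
    middle : ∀ d x → OccAt d T n (at σ) x a ⇔ OccAt (not d) T n (at π) x a
    other : ∀ d x s → s ≢ a → OccAt d T n (at σ) x s ⇔ OccAt d T n (at π) x s

module _ {T} (hooks : All HookCell T) where

  private
    swap-step : ∀ {π a b} → IsPermutation (length π) (at π) → partner T π a ≡ just b →
                FlipStep T a (length π) π (swapValues π a b)
    swap-step {π} {a} {b} P eq with _ , _ , W ← partner-just π P eq = record
      { permutation = perm (length-swapValues π a b) F.isPermutation
      ; middle = F.occAt-middle
      ; other = F.occAt-other }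
      where module F = FlipOccAt P hooks W (swapValues-swapped π a b)

  flipAt-step : ∀ {n π} a → Permutation n π → FlipStep T a n π (flipAt T a π)
  flipAt-step {π = π} a (perm refl P) = step (partner T π a) refl
    where
    step : ∀ mb → partner T π a ≡ mb → FlipStep T a (length π) π (maybe′ (swapValues π a) π mb)
    step (just b) eq = swap-step {π} P eq
    step nothing eq = record
      { permutation = perm refl P
      ; middle = λ d x → mk⇔ (λ (_ , o) → ⊥-elim (partner-nothing π eq o)) (λ (_ , o) → ⊥-elim (partner-nothing π eq o))
      ; other = λ _ _ _ _ → ⇔-refl }

  flipAt-involutive : ∀ {n π} a → Permutation n π → flipAt T a (flipAt T a π) ≡ π
  flipAt-involutive {π = π} a (perm refl P) = involutive (partner T π a) refl
    where
    involutive : ∀ mb → partner T π a ≡ mb → flipAt T a (maybe′ (swapValues π a) π mb) ≡ π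
    involutive nothing eq = cong (maybe′ (swapValues π a) π) eq
    involutive (just b) eq with d₀ , x₀ , W ← partner-just π P eq = back (partner T σ a) refl
      where
      σ = swapValues π a b
      module F = FlipOccAt P hooks W (swapValues-swapped π a b)
      len = length-swapValues π a b
      Pσ : IsPermutation (length σ) (at σ)
      Pσ = subst (λ n → IsPermutation n (at σ)) (sym len) F.isPermutation
      W′ : Occ (not d₀) T (length σ) (at σ) x₀ a b
      W′ = subst (λ n → Occ (not d₀) T n (at σ) x₀ a b) (sym len) F.flipped
      back : ∀ mb → partner T σ a ≡ mb → maybe′ (swapValues σ a) σ mb ≡ π
      back nothing eq′ = ⊥-elim (partner-nothing σ eq′ W′)
      back (just b′) eq′ with _ , _ , W″ ← partner-just σ Pσ eq′ with refl ← Occ-sameMiddle W″ W′ =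
        swapValues-involutive π (Occ.j∈ W) (Occ.k∈ W)

flipAll : List (ℕ × ℕ) → List ℕ → List ℕ → List ℕ
flipAll T []       π = π
flipAll T (a ∷ as) π = flipAll T as (flipAt T a π)

unflipAll : List (ℕ × ℕ) → List ℕ → List ℕ → List ℕ
unflipAll T []       σ = σ
unflipAll T (a ∷ as) σ = flipAt T a (unflipAll T as σ)

module _ {T} (hooks : All HookCell T) where

  flipAll-permutation : ∀ {n π} as → Permutation n π → Permutation n (flipAll T as π)
  flipAll-permutation []       p = p
  flipAll-permutation (a ∷ as) p = flipAll-permutation as (FlipStep.permutation (flipAt-step hooks a p))

  unflipAll-flipAll : ∀ {n π} as → Permutation n π → unflipAll T as (flipAll T as π) ≡ π
  unflipAll-flipAll []       p = refl
  unflipAll-flipAll (a ∷ as) p = trans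
    (cong (flipAt T a) (unflipAll-flipAll as (FlipStep.permutation (flipAt-step hooks a p))))
    (flipAt-involutive hooks a p)

  flipAll-occAt : ∀ {n π} as → Unique as → Permutation n π → ∀ d x s →
    (s ∈ as → OccAt d T n (at (flipAll T as π)) x s ⇔ OccAt (not d) T n (at π) x s) ×
    (s ∉ as → OccAt d T n (at (flipAll T as π)) x s ⇔ OccAt d T n (at π) x s)
  flipAll-occAt [] _ p d x s = (λ ()) , (λ _ → ⇔-refl)
  flipAll-occAt {n} {π} (a ∷ as) (a∉as ∷ unique) p d x s = flipped , unflipped
    where
    module step = FlipStep (flipAt-step hooks a p)
    σ = flipAt T a π
    IH : ∀ d → (s ∈ as → OccAt d T n (at (flipAll T as σ)) x s ⇔ OccAt (not d) T n (at σ) x s) ×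
               (s ∉ as → OccAt d T n (at (flipAll T as σ)) x s ⇔ OccAt d T n (at σ) x s)
    IH d = flipAll-occAt as unique step.permutation d x s
    flipped : s ∈ a ∷ as → OccAt d T n (at (flipAll T as σ)) x s ⇔ OccAt (not d) T n (at π) x s
    flipped (here refl) = ⇔-trans (proj₂ (IH d) (λ a∈as → All.lookup a∉as a∈as refl)) (step.middle d x)
    flipped (there s∈as) =
      ⇔-trans (proj₁ (IH d) s∈as) (step.other (not d) x s (λ { refl → All.lookup a∉as s∈as refl }))
    unflipped : s ∉ a ∷ as → OccAt d T n (at (flipAll T as σ)) x s ⇔ OccAt d T n (at π) x s
    unflipped s∉ = ⇔-trans (proj₂ (IH d) (s∉ ∘ there)) (step.other d x s (s∉ ∘ here))

count : ∀ {A : Set} → (A → Bool) → List A → ℕ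
count p xs = length (filter (λ x → p x ≟ᵇ true) xs)

count-++ : ∀ {A : Set} (p : A → Bool) xs ys → count p (xs ++ ys) ≡ count p xs + count p ys
count-++ p xs ys = trans (cong length (filter-++ (λ x → p x ≟ᵇ true) xs ys)) (length-++ (filter _ xs))

count-map : ∀ {A B : Set} (p : B → Bool) (f : A → B) xs → count p (map f xs) ≡ count (p ∘ f) xs
count-map p f []       = refl
count-map p f (x ∷ xs) with p (f x)
... | true  = cong suc (count-map p f xs)
... | false = count-map p f xs

count-none : ∀ {A : Set} (p : A → Bool) {xs} → (∀ {x} → x ∈ xs → ¬ True (p x)) → count p xs ≡ 0
count-none p none = cong length (filter-none _ (All.tabulate λ x∈ → none x∈ ∘ Equivalence.from T-≡))

count-atMostOne : ∀ {A : Set} (p : A → Bool) {xs} → Unique xs →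
                  (∀ {x y} → x ∈ xs → y ∈ xs → True (p x) → True (p y) → x ≡ y) →
                  count p xs ≡ (if any p xs then 1 else 0)
count-atMostOne p {[]} _ _ = refl
count-atMostOne p {x ∷ xs} (x∉ ∷ unique) atMostOne with p x in px
... | true  = cong suc (count-none p λ y∈ py →
                All.lookup x∉ y∈ (sym (atMostOne (there y∈) (here refl) py (subst True (sym px) _))))
... | false = count-atMostOne p unique (λ x∈ y∈ → atMostOne (there x∈) (there y∈))

choose-head : ∀ lo len k {t} → t ∈ choose lo len (suc k) → ∃[ h ] ∃[ t′ ] t ≡ h ∷ t′ × lo ≤ h
choose-head lo (suc len) k t∈ with ∈-++⁻ (map (lo ∷_) (choose (suc lo) len k)) t∈
... | inj₁ t∈₁ with t′ , _ , refl ← ∈-map⁻ (lo ∷_) t∈₁ = lo , t′ , refl , ≤-refl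
... | inj₂ t∈₂ with h , t′ , refl , lo<h ← choose-head (suc lo) len k t∈₂ = h , t′ , refl , <⇒≤ lo<h

Unique-choose : ∀ lo len k → Unique (choose lo len k)
Unique-choose lo len       zero    = [] ∷ []
Unique-choose lo zero      (suc k) = []
Unique-choose lo (suc len) (suc k) =
  Unique.++⁺ (Unique.map⁺ (λ { refl → refl }) (Unique-choose (suc lo) len k)) (Unique-choose (suc lo) len (suc k)) disjoint
  where
  disjoint : ∀ {t} → ¬ (t ∈ map (lo ∷_) (choose (suc lo) len k) × t ∈ choose (suc lo) len (suc k))
  disjoint (t∈₁ , t∈₂) with _ , _ , refl ← ∈-map⁻ (lo ∷_) t∈₁ | _ , _ , refl , lo<lo ← choose-head (suc lo) len k t∈₂
    = <-irrefl refl lo<lo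

∈-choose₁⁻ : ∀ lo len {t} → t ∈ choose lo len 1 → ∃[ m ] t ≡ m ∷ [] × lo ≤ m × m < lo + len
∈-choose₁⁻ lo (suc len) (here refl) = lo , refl , ≤-refl , m<m+n lo z<s
∈-choose₁⁻ lo (suc len) (there t∈) with m , refl , lo<m , m<1+lo+len ← ∈-choose₁⁻ (suc lo) len t∈ =
  m , refl , <⇒≤ lo<m , subst (m <_) (sym (+-suc lo len)) m<1+lo+len

∈-choose₂⁻ : ∀ lo len {t} → t ∈ choose lo len 2 → ∃[ j ] ∃[ k ] t ≡ j ∷ k ∷ [] × lo ≤ j × j < k × k < lo + len
∈-choose₂⁻ lo (suc len) t∈ with ∈-++⁻ (map (lo ∷_) (choose (suc lo) len 1)) t∈
... | inj₁ t∈₁ with t′ , t′∈ , refl ← ∈-map⁻ (lo ∷_) t∈₁ with k , refl , lo<k , k<1+lo+len ← ∈-choose₁⁻ (suc lo) len t′∈ =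
  lo , k , refl , ≤-refl , lo<k , subst (k <_) (sym (+-suc lo len)) k<1+lo+len
... | inj₂ t∈₂ with j , k , refl , lo<j , j<k , k<1+lo+len ← ∈-choose₂⁻ (suc lo) len t∈₂ =
  j , k , refl , <⇒≤ lo<j , j<k , subst (k <_) (sym (+-suc lo len)) k<1+lo+len

∈-choose₁⁺ : ∀ lo len {m} → lo ≤ m → m < lo + len → m ∷ [] ∈ choose lo len 1
∈-choose₁⁺ lo zero {m} lo≤m m<lo = contradiction (subst (m <_) (+-identityʳ lo) m<lo) (≤⇒≯ lo≤m)
∈-choose₁⁺ lo (suc len) {m} lo≤m m<lo+len with m ≟ lo
... | yes refl = here refl
... | no m≢lo  = there (∈-choose₁⁺ (suc lo) len (≤∧≢⇒< lo≤m (m≢lo ∘ sym)) (subst (m <_) (+-suc lo len) m<lo+len))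

∈-choose₂⁺ : ∀ lo len {j k} → lo ≤ j → j < k → k < lo + len → j ∷ k ∷ [] ∈ choose lo len 2
∈-choose₂⁺ lo zero {j} {k} lo≤j j<k k<lo =
  contradiction (<-trans j<k (subst (k <_) (+-identityʳ lo) k<lo)) (≤⇒≯ lo≤j)
∈-choose₂⁺ lo (suc len) {j} {k} lo≤j j<k k<lo+len with j ≟ lo
... | yes refl = ∈-++⁺ˡ (∈-map⁺ (lo ∷_) (∈-choose₁⁺ (suc lo) len j<k (subst (k <_) (+-suc lo len) k<lo+len)))
... | no j≢lo  = ∈-++⁺ʳ (map (lo ∷_) (choose (suc lo) len 1))
  (∈-choose₂⁺ (suc lo) len (≤∧≢⇒< lo≤j (j≢lo ∘ sym)) j<k (subst (k <_) (+-suc lo len) k<lo+len))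

count-choose₃ : ∀ (p q : List ℕ → Bool) lo len →
  (∀ x l → lo ≤ x → x + suc l ≡ lo + len → count (p ∘ (x ∷_)) (choose (suc x) l 2) ≡ count (q ∘ (x ∷_)) (choose (suc x) l 2)) →
  count p (choose lo len 3) ≡ count q (choose lo len 3)
count-choose₃ p q lo zero      eq = refl
count-choose₃ p q lo (suc len) eq = begin
  count p (map (lo ∷_) pairs ++ rest)                  ≡⟨ count-++ p (map (lo ∷_) pairs) rest ⟩
  count p (map (lo ∷_) pairs) + count p rest           ≡⟨ cong₂ _+_ (count-map p (lo ∷_) pairs) (count-choose₃ p q (suc lo) len eq′) ⟩
  count (p ∘ (lo ∷_)) pairs + count q rest             ≡⟨ cong (_+ count q rest) (eq lo len ≤-refl refl) ⟩
  count (q ∘ (lo ∷_)) pairs + count q rest             ≡⟨ cong (_+ count q rest) (count-map q (lo ∷_) pairs) ⟨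
  count q (map (lo ∷_) pairs) + count q rest           ≡⟨ count-++ q (map (lo ∷_) pairs) rest ⟨
  count q (map (lo ∷_) pairs ++ rest)                  ∎
  where
  open ≡-Reasoning
  pairs = choose (suc lo) len 2
  rest = choose (suc lo) len 3
  eq′ : ∀ x l → suc lo ≤ x → x + suc l ≡ suc lo + len →
        count (p ∘ (x ∷_)) (choose (suc x) l 2) ≡ count (q ∘ (x ∷_)) (choose (suc x) l 2)
  eq′ x l lo<x e = eq x l (<⇒≤ lo<x) (trans e (sym (+-suc lo len)))

IsRoot : Bool → List (ℕ × ℕ) → ℕ → (ℕ → ℕ) → ℕ → Set
IsRoot d T n f x = ∃[ s ] OccAt d T n f x s

module _ (d : Bool) (T : List (ℕ × ℕ)) (π : List ℕ) {x l : ℕ} (0<x : 0 < x) where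

  private
    isOccAt = isOcc (meshPattern d T) π ∘ (x ∷_)
    pairs = choose (suc x) l 2

    pair-bounds : x + l ≡ length π → ∀ {t} → t ∈ pairs → ∃[ j ] ∃[ k ] t ≡ j ∷ k ∷ [] × x < j × j < k × k ≤ length π
    pair-bounds x+l≡n t∈ with j , k , refl , x<j , j<k , k<1+x+l ← ∈-choose₂⁻ (suc x) l t∈ =
      j , k , refl , x<j , j<k , subst (k ≤_) x+l≡n (≤-pred k<1+x+l)

  any-pair⇔IsRoot : ∀ {n} → Permutation n π → x + l ≡ n → True (any isOccAt pairs) ⇔ IsRoot d T n (at π) x
  any-pair⇔IsRoot (perm refl P) x+l≡n = mk⇔ to from
    where
    to : True (any isOccAt pairs) → IsRoot d T (length π) (at π) x
    to t with _ , t∈ , occurs ← find (any⁻ _ pairs t) with j , k , refl , x<j , j<k , k≤n ← pair-bounds x+l≡n t∈ =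
      j , k , isOcc⇒Occ d T π P 0<x x<j j<k k≤n occurs
    from : IsRoot d T (length π) (at π) x → True (any isOccAt pairs)
    from (j , k , o) = any⁺ _ (lose (∈-choose₂⁺ (suc x) l (Occ.x<j o) (Occ.j<k o) k<1+x+l) (Occ⇒isOcc d T π o))
      where k<1+x+l = subst (k <_) (cong suc (sym x+l≡n)) (s≤s (Occ.k≤n o))

  count-pairs : ∀ {n} → Permutation n π → x + l ≡ n → count isOccAt pairs ≡ (if any isOccAt pairs then 1 else 0)
  count-pairs (perm refl P) x+l≡n = count-atMostOne isOccAt (Unique-choose (suc x) l 2) atMostOne
    where
    atMostOne : ∀ {t t′} → t ∈ pairs → t′ ∈ pairs → True (isOccAt t) → True (isOccAt t′) → t ≡ t′
    atMostOne t∈ t′∈ occurs occurs′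
      with j , k , refl , x<j , j<k , k≤n ← pair-bounds x+l≡n t∈ | j′ , k′ , refl , x<j′ , j′<k′ , k′≤n ← pair-bounds x+l≡n t′∈
      with refl , refl ← Occ-samePair (isOcc⇒Occ d T π P 0<x x<j j<k k≤n occurs) (isOcc⇒Occ d T π P 0<x x<j′ j′<k′ k′≤n occurs′)
      = refl

occ≡count : ∀ d T π → occ (meshPattern d T) π ≡ count (isOcc (meshPattern d T) π) (choose 1 (length π) 3)
occ≡count true  T π = refl
occ≡count false T π = refl

occ-cong : ∀ d d′ T {n σ π} → Permutation n σ → Permutation n π →
           (∀ {x} → InRange n x → IsRoot d T n (at σ) x ⇔ IsRoot d′ T n (at π) x) →
           occ (meshPattern d T) σ ≡ occ (meshPattern d′ T) π
occ-cong d d′ T {n} {σ} {π} pσ@(perm refl _) pπ@(perm len _) roots = begin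
  occ (meshPattern d T) σ                                ≡⟨ occ≡count d T σ ⟩
  count (isOcc (meshPattern d T) σ) (choose 1 n 3)       ≡⟨ count-choose₃ _ _ 1 n same-roots ⟩
  count (isOcc (meshPattern d′ T) π) (choose 1 n 3)      ≡⟨ cong (λ m → count (isOcc (meshPattern d′ T) π) (choose 1 m 3)) len ⟨
  count (isOcc (meshPattern d′ T) π) (choose 1 (length π) 3)  ≡⟨ occ≡count d′ T π ⟨
  occ (meshPattern d′ T) π                               ∎
  where
  open ≡-Reasoning
  same-roots : ∀ x l → 1 ≤ x → x + suc l ≡ 1 + n →
               count (isOcc (meshPattern d T) σ ∘ (x ∷_)) (choose (suc x) l 2) ≡
               count (isOcc (meshPattern d′ T) π ∘ (x ∷_)) (choose (suc x) l 2)
  same-roots x l 0<x x+1+l≡1+n = begin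
    count _ (choose (suc x) l 2)                  ≡⟨ count-pairs d T σ 0<x pσ x+l≡n ⟩
    (if any _ (choose (suc x) l 2) then 1 else 0) ≡⟨ cong (if_then 1 else 0) any≡any ⟩
    (if any _ (choose (suc x) l 2) then 1 else 0) ≡⟨ count-pairs d′ T π 0<x pπ x+l≡n ⟨
    count _ (choose (suc x) l 2)                  ∎
    where
    x+l≡n = suc-injective (trans (sym (+-suc x l)) x+1+l≡1+n)
    x∈ : InRange n x
    x∈ = 0<x , subst (x ≤_) x+l≡n (m≤m+n x l)
    any≡any = ⇔→≡ {z = true} (⇔-trans (⇔-sym T-≡) (⇔-trans (any-pair⇔IsRoot d T σ 0<x pσ x+l≡n)
                (⇔-trans (roots x∈) (⇔-trans (⇔-sym (any-pair⇔IsRoot d′ T π 0<x pπ x+l≡n)) T-≡))))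

at-∈ : ∀ xs {m} → InRange (length xs) m → at xs m ∈ xs
at-∈ (x ∷ xs) {suc zero}    _             = here refl
at-∈ (x ∷ xs) {suc (suc m)} (_ , s≤s m<n) = there (at-∈ xs (z<s , m<n))

∈-at : ∀ xs {y} → y ∈ xs → ∃[ m ] InRange (length xs) m × at xs m ≡ y
∈-at (x ∷ xs) (here refl) = 1 , (z<s , s≤s z≤n) , refl
∈-at (x ∷ xs) (there y∈) with suc m , (_ , m≤n) , eq ← ∈-at xs y∈ = suc (suc m) , (z<s , s≤s m≤n) , eq

All⇒at : ∀ {P : ℕ → Set} xs → All P xs → ∀ {m} → InRange (length xs) m → P (at xs m)
All⇒at xs ps m∈ = All.lookup ps (at-∈ xs m∈)

at⇒All : ∀ {P : ℕ → Set} xs → (∀ {m} → InRange (length xs) m → P (at xs m)) → All P xs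
at⇒All {P} xs h = All.tabulate λ y∈ → let _ , m∈ , eq = ∈-at xs y∈ in subst P eq (h m∈)

memb⇒∈ : ∀ {x} xs → True (memb x xs) → x ∈ xs
memb⇒∈ {x} xs t = Any.map (≡ᵇ⇒≡ x _) (any⁻ _ xs t)

∈⇒memb : ∀ {x xs} → x ∈ xs → True (memb x xs)
∈⇒memb {x} x∈ = any⁺ _ (Any.map (≡⇒≡ᵇ x _) x∈)

distinct⇒Unique : ∀ xs → True (distinct xs) → Unique xs
distinct⇒Unique []       _ = []
distinct⇒Unique (x ∷ xs) t =
  let ¬memb , t = True-∧⁻ (not (memb x xs)) t
  in All.tabulate (λ y∈ x≡y → True-not⁻ ¬memb (∈⇒memb (subst (_∈ xs) (sym x≡y) y∈))) ∷ distinct⇒Unique xs t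

Unique⇒distinct : ∀ {xs} → Unique xs → True (distinct xs)
Unique⇒distinct []            = _
Unique⇒distinct (x∉ ∷ unique) =
  True-∧⁺ (True-not⁺ λ t → All.lookup x∉ (memb⇒∈ _ t) refl) (Unique⇒distinct unique)

Unique⇒at-injective : ∀ {xs} → Unique xs → ∀ {m m′} → InRange (length xs) m → InRange (length xs) m′ →
                      at xs m ≡ at xs m′ → m ≡ m′
Unique⇒at-injective (_ ∷ _) {suc zero} {suc zero} _ _ _ = refl
Unique⇒at-injective {x ∷ xs} (x∉ ∷ _) {suc zero} {suc (suc m′)} _ (_ , s≤s m′<n) eq =
  contradiction eq (All.lookup x∉ (at-∈ xs (z<s , m′<n)))
Unique⇒at-injective {x ∷ xs} (x∉ ∷ _) {suc (suc m)} {suc zero} (_ , s≤s m<n) _ eq =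
  contradiction (sym eq) (All.lookup x∉ (at-∈ xs (z<s , m<n)))
Unique⇒at-injective (_ ∷ unique) {suc (suc m)} {suc (suc m′)} (_ , s≤s m<n) (_ , s≤s m′<n) eq =
  cong suc (Unique⇒at-injective unique (z<s , m<n) (z<s , m′<n) eq)

at-injective⇒Unique : ∀ xs → (∀ {m m′} → InRange (length xs) m → InRange (length xs) m′ → at xs m ≡ at xs m′ → m ≡ m′) →
                      Unique xs
at-injective⇒Unique []       _   = []
at-injective⇒Unique (x ∷ xs) inj = All.tabulate x∉ ∷ at-injective⇒Unique xs inj′
  where
  x∉ : ∀ {y} → y ∈ xs → x ≢ y
  x∉ y∈ x≡y with suc m , (_ , m≤n) , eq ← ∈-at xs y∈ =
    contradiction (inj (z<s , s≤s z≤n) (z<s , s≤s m≤n) (trans x≡y (sym eq))) λ ()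
  inj′ : ∀ {m m′} → InRange (length xs) m → InRange (length xs) m′ → at xs m ≡ at xs m′ → m ≡ m′
  inj′ {suc m} {suc m′} (_ , m≤n) (_ , m′≤n) eq = suc-injective (inj (z<s , s≤s m≤n) (z<s , s≤s m′≤n) eq)

∈-words⁻ : ∀ n k {w} → w ∈ words n k → length w ≡ k × All (InRange n) w
∈-words⁻ n zero    (here refl) = refl , []
∈-words⁻ n (suc k) w∈ with find (concatMap⁻ (λ x → map (x ∷_) (words n k)) {xs = range1 n} w∈)
... | x , x∈ , w∈′ with w′ , w′∈ , refl ← ∈-map⁻ (x ∷_) w∈′ =
  let len , inRange = ∈-words⁻ n k w′∈ in cong suc len , ∈-range1⁻ x∈ ∷ inRange

∈-words⁺ : ∀ n {w} → All (InRange n) w → w ∈ words n (length w)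
∈-words⁺ n []                = here refl
∈-words⁺ n {x ∷ w} (x∈ ∷ w∈) =
  concatMap⁺ (λ x → map (x ∷_) (words n (length w))) (Any.map (λ { refl → ∈-map⁺ (x ∷_) (∈-words⁺ n w∈) }) (∈-range1⁺ x∈))

Unique-words : ∀ n k → Unique (words n k)
Unique-words n zero    = [] ∷ []
Unique-words n (suc k) = Unique-concat (range1 n) (Unique-range1 n)
  where
  Unique-concat : ∀ xs → Unique xs → Unique (concatMap (λ x → map (x ∷_) (words n k)) xs)
  Unique-concat []       []            = []
  Unique-concat (x ∷ xs) (x∉ ∷ unique) =
    Unique.++⁺ (Unique.map⁺ (λ { refl → refl }) (Unique-words n k)) (Unique-concat xs unique) disjoint
    where
    disjoint : ∀ {w} → ¬ (w ∈ map (x ∷_) (words n k) × w ∈ concatMap (λ x → map (x ∷_) (words n k)) xs)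
    disjoint (w∈₁ , w∈₂) with _ , _ , refl ← ∈-map⁻ (x ∷_) w∈₁
                         with x′ , x′∈ , w∈′ ← find (concatMap⁻ (λ x → map (x ∷_) (words n k)) {xs = xs} w∈₂)
                         with _ , _ , refl ← ∈-map⁻ (x′ ∷_) w∈′
      = All.lookup x∉ x′∈ refl

∈-perms⁻ : ∀ n {π} → π ∈ perms n → Permutation n π
∈-perms⁻ n {π} π∈ with π∈words , distinct≡true ← ∈-filter⁻ (λ w → distinct w ≟ᵇ true) {xs = words n n} π∈
              with refl , inRange ← ∈-words⁻ n n π∈words
  = perm refl (record
      { inRange = All⇒at _ inRange
      ; injective = Unique⇒at-injective (distinct⇒Unique π (Equivalence.from T-≡ distinct≡true)) })

∈-perms⁺ : ∀ n {π} → Permutation n π → π ∈ perms n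
∈-perms⁺ n {π} (perm refl P) = ∈-filter⁺ (λ w → distinct w ≟ᵇ true) (∈-words⁺ n (at⇒All π (inRange P)))
  (Equivalence.to T-≡ (Unique⇒distinct (at-injective⇒Unique π (injective P))))

Unique-perms : ∀ n → Unique (perms n)
Unique-perms n = Unique.filter⁺ (λ w → distinct w ≟ᵇ true) (Unique-words n n)

length-≤ : ∀ {A : Set} {xs ys : List A} → Unique xs → (∀ {x} → x ∈ xs → x ∈ ys) → length xs ≤ length ys
length-≤ {xs = []}     _            _   = z≤n
length-≤ {xs = x ∷ xs} (x∉ ∷ unique) xs⊆ys with us , vs , refl ← ∈-∃++ (xs⊆ys (here refl)) = begin
  suc (length xs)            ≤⟨ s≤s (length-≤ unique xs⊆us++vs) ⟩
  suc (length (us ++ vs))    ≡⟨ cong suc (length-++ us) ⟩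
  suc (length us + length vs) ≡⟨ +-suc (length us) (length vs) ⟨
  length us + suc (length vs) ≡⟨ length-++ us ⟨
  length (us ++ x ∷ vs)      ∎
  where
  open ≤-Reasoning
  xs⊆us++vs : ∀ {y} → y ∈ xs → y ∈ us ++ vs
  xs⊆us++vs {y} y∈ with ∈-++⁻ us (xs⊆ys (there y∈))
  ... | inj₁ y∈us         = ∈-++⁺ˡ y∈us
  ... | inj₂ (here refl)  = contradiction refl (All.lookup x∉ y∈)
  ... | inj₂ (there y∈vs) = ∈-++⁺ʳ us y∈vs

Unique-map-injectiveOn : ∀ {A B : Set} (f : A → B) {xs} → Unique xs →
                         (∀ {x y} → x ∈ xs → y ∈ xs → f x ≡ f y → x ≡ y) → Unique (map f xs)
Unique-map-injectiveOn f []            _   = []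
Unique-map-injectiveOn f {x ∷ xs} (x∉ ∷ unique) inj =
  All.tabulate fx∉ ∷ Unique-map-injectiveOn f unique (λ x∈ y∈ → inj (there x∈) (there y∈))
  where
  fx∉ : ∀ {z} → z ∈ map f xs → f x ≢ z
  fx∉ z∈ fx≡z with y , y∈ , refl ← ∈-map⁻ f z∈ = All.lookup x∉ y∈ (inj (here refl) (there y∈) fx≡z)

length-≤-injection : ∀ {A B : Set} (f : A → B) {xs ys} → Unique xs → (∀ {x} → x ∈ xs → f x ∈ ys) →
                     (∀ {x y} → x ∈ xs → y ∈ xs → f x ≡ f y → x ≡ y) → length xs ≤ length ys
length-≤-injection f {xs} unique into inj =
  subst (_≤ _) (length-map f xs) (length-≤ (Unique-map-injectiveOn f unique inj) image⊆)
  where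
  image⊆ : ∀ {z} → z ∈ map f xs → z ∈ _
  image⊆ z∈ with x , x∈ , refl ← ∈-map⁻ f z∈ = into x∈

flipEverywhere : List (ℕ × ℕ) → List ℕ → List ℕ
flipEverywhere T π = flipAll T (range1 (length π)) π

module _ {T} (hooks : All HookCell T) where

  flipEverywhere-permutation : ∀ {n π} → Permutation n π → Permutation n (flipEverywhere T π)
  flipEverywhere-permutation {π = π} p = flipAll-permutation hooks (range1 (length π)) p

  flipEverywhere-occ : ∀ d {n π} → Permutation n π → occ (meshPattern d T) (flipEverywhere T π) ≡ occ (meshPattern (not d) T) π
  flipEverywhere-occ d {π = π} p@(perm refl _) =
    occ-cong d (not d) T (flipEverywhere-permutation p) p λ _ → mk⇔
      (λ (s , k , o) → s , Equivalence.to (flipped s (range1-middle o)) (k , o))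
      (λ (s , k , o) → s , Equivalence.from (flipped s (range1-middle o)) (k , o))
    where
    flipped : ∀ {x} s → s ∈ range1 (length π) →
              OccAt d T (length π) (at (flipEverywhere T π)) x s ⇔ OccAt (not d) T (length π) (at π) x s
    flipped {x} s = proj₁ (flipAll-occAt hooks (range1 (length π)) (Unique-range1 (length π)) p d x s)
    range1-middle : ∀ {d f x s k} → Occ d T (length π) f x s k → s ∈ range1 (length π)
    range1-middle o = ∈-range1⁺ (Occ.j∈ o)

  flipEverywhere-injective : ∀ {n π π′} → Permutation n π → Permutation n π′ →
                             flipEverywhere T π ≡ flipEverywhere T π′ → π ≡ π′
  flipEverywhere-injective {π = π} {π′} p@(perm refl _) p′@(perm len′ _) eq = begin
    π                                                     ≡⟨ unflipAll-flipAll hooks (range1 (length π)) p ⟨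
    unflipAll T (range1 (length π)) (flipEverywhere T π)  ≡⟨ cong (unflipAll T (range1 (length π))) eq ⟩
    unflipAll T (range1 (length π)) (flipEverywhere T π′) ≡⟨ cong (λ n → unflipAll T (range1 n) (flipEverywhere T π′)) len′ ⟨
    unflipAll T (range1 (length π′)) (flipEverywhere T π′) ≡⟨ unflipAll-flipAll hooks (range1 (length π′)) p′ ⟩
    π′                                                    ∎
    where open ≡-Reasoning

  countPerms-≤ : ∀ d n ℓ → countPerms (meshPattern (not d) T) n ℓ ≤ countPerms (meshPattern d T) n ℓ
  countPerms-≤ d n ℓ =
    length-≤-injection (flipEverywhere T) (Unique.filter⁺ (λ π → occ (meshPattern (not d) T) π ≟ ℓ) (Unique-perms n))
                       into injectiveOn
    where
    withOcc : Bool → List (List ℕ)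
    withOcc d = filter (λ π → occ (meshPattern d T) π ≟ ℓ) (perms n)
    member⁻ : ∀ d {π} → π ∈ withOcc d → Permutation n π × occ (meshPattern d T) π ≡ ℓ
    member⁻ d π∈ = let π∈perms , occ≡ℓ = ∈-filter⁻ (λ π → occ (meshPattern d T) π ≟ ℓ) {xs = perms n} π∈
                   in ∈-perms⁻ n π∈perms , occ≡ℓ
    into : ∀ {π} → π ∈ withOcc (not d) → flipEverywhere T π ∈ withOcc d
    into π∈ = let p , occ≡ℓ = member⁻ (not d) π∈ in
      ∈-filter⁺ (λ π → occ (meshPattern d T) π ≟ ℓ) (∈-perms⁺ n (flipEverywhere-permutation p))
        (trans (flipEverywhere-occ d p) occ≡ℓ)
    injectiveOn : ∀ {π π′} → π ∈ withOcc (not d) → π′ ∈ withOcc (not d) → flipEverywhere T π ≡ flipEverywhere T π′ → π ≡ π′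
    injectiveOn π∈ π′∈ = flipEverywhere-injective (proj₁ (member⁻ (not d) π∈)) (proj₁ (member⁻ (not d) π′∈))

Ts-hooks : ∀ {T} → T ∈ Ts → All HookCell T
Ts-hooks (here refl)                                                 = c00 ∷ []
Ts-hooks (there (here refl))                                         = c01 ∷ c10 ∷ []
Ts-hooks (there (there (here refl)))                                 = c00 ∷ c01 ∷ c10 ∷ []
Ts-hooks (there (there (there (here refl))))                         = c02 ∷ c20 ∷ []
Ts-hooks (there (there (there (there (here refl)))))                 = c00 ∷ c02 ∷ c20 ∷ []
Ts-hooks (there (there (there (there (there (here refl))))))         = c01 ∷ c02 ∷ c10 ∷ c20 ∷ []
Ts-hooks (there (there (there (there (there (there (here refl))))))) = c00 ∷ c01 ∷ c02 ∷ c10 ∷ c20 ∷ []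

theorem4p2 : ∀ T → T ∈ Ts → mesh p123 (B ++ T) ∼d mesh p132 (B ++ T)
theorem4p2 T T∈Ts n ℓ = ≤-antisym (countPerms-≤ hooks false n ℓ) (countPerms-≤ hooks true n ℓ)
  where hooks = Ts-hooks T∈Ts
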